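{- For a composition $J=(j_1,\dots,j_k)$ of $n$ of length $k$, $$\sum_{I\vDash n,\ \ell(I)=k}c_{IJ}\prod_{s=1}^k x_s^{i_s-1}=\prod_{s=1}^k(x_s+x_{s+1}+\cdots+x_k)^{j_s-1},$$ where the sum is over compositions $I=(i_1,\dots,i_k)$ of $n$ of length $k$ and $x_1,\dots,x_k$ are commuting indeterminates.
   Context: $c_{IJ}$ is the number of set partitions $\pi$ of $\{1,\dots,n\}$ such that $K(\pi)=I$ and $C(\pi)=J$, where, ordering the blocks of $\pi$ by increasing maximal elements $m_1<\dots<m_k=n$, $C(\pi)=(m_1,m_2-m_1,\dots,m_k-m_{k-1})$ and $K(\pi)$ is the sequence of sizes of the blocks in that order. -}

module Defs where

open import Data.Bool using (Bool; true; false; _∧_; _∨_; not; if_then_else_)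
open import Data.Nat using (ℕ; zero; suc; _∸_; _<ᵇ_; _≤ᵇ_; _≡ᵇ_)
open import Data.Fin using (Fin; toℕ)
open import Data.List using (List; []; _∷_; map; filterᵇ; length; upTo; concatMap; allFin)
open import Data.Bool.ListAction using (all; any)
open import Data.Vec using (Vec; lookup; toList)
import Data.Vec as Vec
open import Algebra.Bundles using (CommutativeSemiring)

allFuns : {A : Set} → List A → (m : ℕ) → List (Fin m → A)
allFuns xs zero = (λ ()) ∷ []
allFuns xs (suc m) =
  concatMap (λ a → map (λ f → λ { Fin.zero → a ; (Fin.suc i) → f i }) (allFuns xs m)) xs

allVecs : {A : Set} → List A → (m : ℕ) → List (Vec A m)
allVecs xs zero = Vec.[] ∷ []
allVecs xs (suc m) = concatMap (λ a → map (a Vec.∷_) (allVecs xs m)) xs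

allB : {m : ℕ} → (Fin m → Bool) → Bool
allB {m} p = all p (allFin m)

anyB : {m : ℕ} → (Fin m → Bool) → Bool
anyB {m} p = any p (allFin m)

countB : {m : ℕ} → (Fin m → Bool) → ℕ
countB {m} p = length (filterᵇ p (allFin m))

listEqᵇ : List ℕ → List ℕ → Bool
listEqᵇ [] [] = true
listEqᵇ (a ∷ as) (b ∷ bs) = (a ≡ᵇ b) ∧ listEqᵇ as bs
listEqᵇ _ _ = false

-- Set partitions of {1,…,n}, represented (as usual) by their equivalence
-- relation on Fin n (element i : Fin n stands for toℕ i + 1).

BRel : ℕ → Set
BRel n = Fin n → Fin n → Bool

isEquivᵇ : {n : ℕ} → BRel n → Bool
isEquivᵇ R =
  allB (λ i → R i i) ∧
  allB (λ i → allB (λ j → not (R i j) ∨ R j i)) ∧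
  allB (λ i → allB (λ j → allB (λ l → not (R i j ∧ R j l) ∨ R i l)))

allRels : (n : ℕ) → List (BRel n)
allRels n = allFuns (allFuns (true ∷ false ∷ []) n) n

setPartitions : (n : ℕ) → List (BRel n)
setPartitions n = filterᵇ isEquivᵇ (allRels n)

isBlockMax : {n : ℕ} → BRel n → Fin n → Bool
isBlockMax R i = not (anyB (λ j → (toℕ i <ᵇ toℕ j) ∧ R i j))

blockMaxima : {n : ℕ} → BRel n → List (Fin n)
blockMaxima {n} R = filterᵇ (isBlockMax R) (allFin n)

diffs : ℕ → List ℕ → List ℕ
diffs p [] = []
diffs p (m ∷ ms) = (m ∸ p) ∷ diffs m ms

Cπ : {n : ℕ} → BRel n → List ℕ
Cπ R = diffs 0 (map (λ m → suc (toℕ m)) (blockMaxima R))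

Kπ : {n : ℕ} → BRel n → List ℕ
Kπ R = map (λ m → countB (λ j → R j m)) (blockMaxima R)

cIJ : (n : ℕ) {k : ℕ} → Vec ℕ k → Vec ℕ k → ℕ
cIJ n I J = length (filterᵇ (λ R → listEqᵇ (Kπ R) (toList I) ∧ listEqᵇ (Cπ R) (toList J))
                            (setPartitions n))

compositions : (n k : ℕ) → List (Vec ℕ k)
compositions n k = filterᵇ (λ v → Vec.sum v ≡ᵇ n) (allVecs (map suc (upTo n)) k)

module SemiringOps {c ℓ} (R : CommutativeSemiring c ℓ) where
  open CommutativeSemiring R

  pow : Carrier → ℕ → Carrier
  pow x zero = 1#
  pow x (suc e) = x * pow x e

  natMul : ℕ → Carrier → Carrier
  natMul zero x = 0#
  natMul (suc m) x = x + natMul m x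

  ∑ : {k : ℕ} → (Fin k → Carrier) → Carrier
  ∑ {zero} f = 0#
  ∑ {suc k} f = f Fin.zero + ∑ (λ i → f (Fin.suc i))

  ∏ : {k : ℕ} → (Fin k → Carrier) → Carrier
  ∏ {zero} f = 1#
  ∏ {suc k} f = f Fin.zero * ∏ (λ i → f (Fin.suc i))

  ∑L : {A : Set} → List A → (A → Carrier) → Carrier
  ∑L [] f = 0#
  ∑L (a ∷ as) f = f a + ∑L as f

  tailSum : {k : ℕ} → (Fin k → Carrier) → Fin k → Carrier
  tailSum x s = ∑ (λ t → if toℕ s ≤ᵇ toℕ t then x t else 0#)

-- A set partition π of {1,…,n} with C(π) = J has its block maxima at the fixed positions
-- m_s = j₁ + ⋯ + j_s, so it is determined by the labelling g sending each element to the index of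
-- its block. The labellings that arise are exactly those with g(m_s) = s and e < m_{g(e)} for every
-- other e, and K(π)_s − 1 counts the non-maximal elements labelled s. The left-hand side is therefore
-- the sum over these labellings of ∏ x_{g(e)} over the non-maximal e, which factorises over e: the
-- j_s − 1 non-maximal e between m_{s−1} and m_s admit exactly the labels s,…,k, so each of them
-- contributes the factor x_s + ⋯ + x_k.

module Submission where

open import Defs
open import Algebra.Bundles using (CommutativeSemiring)
open import Data.Bool using (Bool; true; false; _∧_; _∨_; not; if_then_else_; T)
import Data.Bool.Properties as Bool
open import Data.Bool.Properties using (T-∧; ∨-identityʳ; if-not)
open import Data.Bool.ListAction using (and; or)
open import Data.Empty using (⊥; ⊥-elim)
open import Data.Fin as Fin using (Fin; toℕ; _↑ˡ_; _↑ʳ_)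
import Data.Fin.Induction as Fin
import Data.Fin.Properties as Fin
open import Data.List as List using (List; []; _∷_; map; filterᵇ; length; tabulate; allFin; _++_; concatMap)
import Data.List.Properties as List
open import Data.List.Membership.Propositional using (_∈_; lose)
open import Data.List.Membership.Propositional.Properties using (∈-allFin; ∈-filter⁺; ∈-filter⁻)
import Data.List.Relation.Unary.All as All
open import Data.List.Relation.Unary.All.Properties using (all⁺; all⁻; tabulate⁺; all-upTo)
import Data.List.Relation.Unary.Any as Any
open import Data.List.Relation.Unary.Any.Properties using (any⁺; any⁻)
open import Data.Nat as ℕ using (ℕ; zero; suc; _+_; _∸_; _≤_; _<_; _≡ᵇ_; _≤ᵇ_; _<ᵇ_; s≤s)
import Data.Nat.Properties as ℕ
open import Data.Product using (∃; _×_; _,_; proj₁; proj₂; uncurry)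
open import Data.Vec as Vec using (Vec; lookup; toList)
import Data.Vec.Properties as Vec
open import Data.Vec.Relation.Binary.Equality.Cast using (cast-is-id)
open import Function using (_∘_; id; _⇔_; mk⇔; Equivalence)
open import Induction.WellFounded using (Acc; acc)
open import Relation.Binary.Definitions using (tri<; tri≈; tri>)
open import Relation.Binary.PropositionalEquality as ≡ using (_≡_; _≗_; refl; cong; cong₂)
open import Relation.Binary.Structures using (IsEquivalence)
open import Relation.Nullary using (¬_; Dec; yes; no)
open import Relation.Nullary.Decidable using (T?; does)

open import Algebra.Properties.CommutativeSemigroup ℕ.+-commutativeSemigroup
  using () renaming (interchange to +-interchange)

private
  variable
    A B : Set

¬T⇒≡false : ∀ {b} → ¬ T b → b ≡ false
¬T⇒≡false {true} ¬t = ⊥-elim (¬t _)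
¬T⇒≡false {false} _ = refl

if-T : ∀ {a} {A : Set a} {b} {x y : A} → T b → (if b then x else y) ≡ x
if-T {b = true} _ = refl

if-¬T : ∀ {a} {A : Set a} {b} {x y : A} → ¬ T b → (if b then x else y) ≡ y
if-¬T {b = true} ¬t = ⊥-elim (¬t _)
if-¬T {b = false} _ = refl

-- Decisions are read through `does` rather than ⌊_⌋: `does (suc i Fin.≟ suc j)` reduces to
-- `does (i Fin.≟ j)`, which the counting lemmas over Fin rely on.
does-sound : ∀ {P : Set} {d : Dec P} → T (does d) → P
does-sound {d = yes p} _ = p

does-complete : ∀ {P : Set} {d : Dec P} → P → T (does d)
does-complete {d = yes _} _ = _
does-complete {d = no ¬p} p = ¬p p

∧-intro : ∀ {a b} → T a → T b → T (a ∧ b)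
∧-intro ta tb = Equivalence.from T-∧ (ta , tb)

∧-elim : ∀ {a b} → T (a ∧ b) → T a × T b
∧-elim = Equivalence.to T-∧

implies-sound : ∀ {a b} → T (not a ∨ b) → T a → T b
implies-sound {true} t _ = t

implies-complete : ∀ {a b} → (T a → T b) → T (not a ∨ b)
implies-complete {true} f = f _
implies-complete {false} _ = _

T-not⇒¬T : ∀ {b} → T (not b) → ¬ T b
T-not⇒¬T {false} _ ()

¬T⇒T-not : ∀ {b} → ¬ T b → T (not b)
¬T⇒T-not {true} ¬t = ¬t _
¬T⇒T-not {false} _ = _

¬T-not⇒T : ∀ {b} → ¬ T (not b) → T b
¬T-not⇒T {true} _ = _
¬T-not⇒T {false} ¬t = ¬t _

T-⇔⇒≡ : ∀ {a b} → (T a → T b) → (T b → T a) → a ≡ b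
T-⇔⇒≡ {true} {true} _ _ = refl
T-⇔⇒≡ {true} {false} to _ = ⊥-elim (to _)
T-⇔⇒≡ {false} {true} _ from = ⊥-elim (from _)
T-⇔⇒≡ {false} {false} _ _ = refl

bit : Bool → ℕ
bit b = if b then 1 else 0

filterᵇ-cong : ∀ {p q : A → Bool} → p ≗ q → filterᵇ p ≗ filterᵇ q
filterᵇ-cong {p = p} {q} p≗q =
  List.filter-≐ (T? ∘ p) (T? ∘ q) ((λ {x} → ≡.subst T (p≗q x)) , (λ {x} → ≡.subst T (≡.sym (p≗q x))))

filterᵇ-map : ∀ (p : B → Bool) (f : A → B) xs → filterᵇ p (map f xs) ≡ map f (filterᵇ (p ∘ f) xs)
filterᵇ-map p f [] = refl
filterᵇ-map p f (x ∷ xs) with p (f x)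
... | true = cong (f x ∷_) (filterᵇ-map p f xs)
... | false = filterᵇ-map p f xs

length-filterᵇ-∷ : ∀ (p : A → Bool) x xs → length (filterᵇ p (x ∷ xs)) ≡ bit (p x) + length (filterᵇ p xs)
length-filterᵇ-∷ p x xs with p x
... | true = refl
... | false = refl

applyUpTo-+ : ∀ (f : ℕ → A) m n → List.applyUpTo f (m + n) ≡ List.applyUpTo f m ++ List.applyUpTo (f ∘ (m +_)) n
applyUpTo-+ f zero n = refl
applyUpTo-+ f (suc m) n = cong (f 0 ∷_) (applyUpTo-+ (f ∘ suc) m n)

tabulate-toℕ : ∀ (f : ℕ → A) n → tabulate {n = n} (f ∘ toℕ) ≡ List.applyUpTo f n
tabulate-toℕ f zero = refl
tabulate-toℕ f (suc n) = cong (f 0 ∷_) (tabulate-toℕ (f ∘ suc) n)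

filterᵇ-upTo-last : ∀ (q : ℕ → Bool) j → (∀ {e} → e ≤ j → q e ≡ (e ≡ᵇ j)) →
                    filterᵇ q (List.upTo (suc j)) ≡ j ∷ []
filterᵇ-upTo-last q j q≡ = begin
  filterᵇ q (List.upTo (suc j))                         ≡⟨ cong (filterᵇ q) (List.upTo-∷ʳ j) ⟨
  filterᵇ q (List.upTo j ++ j ∷ [])                     ≡⟨ List.filter-++ (T? ∘ q) (List.upTo j) (j ∷ []) ⟩
  filterᵇ q (List.upTo j) ++ filterᵇ q (j ∷ [])         ≡⟨ cong₂ _++_ below (List.filter-accept (T? ∘ q) at-j) ⟩
  j ∷ []                                                ∎
  where
  open ≡.≡-Reasoning
  below : filterᵇ q (List.upTo j) ≡ []
  below = List.filter-none (T? ∘ q) (All.map rejected (all-upTo j))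
    where
    rejected : ∀ {e} → e < j → ¬ T (q e)
    rejected e<j t = ℕ.<⇒≢ e<j (ℕ.≡ᵇ⇒≡ _ j (≡.subst T (q≡ (ℕ.<⇒≤ e<j)) t))
  at-j : T (q j)
  at-j = ≡.subst T (≡.sym (q≡ ℕ.≤-refl)) (ℕ.≡⇒≡ᵇ j j refl)

toList-tabulate : ∀ {m} (f : Fin m → A) → toList (Vec.tabulate f) ≡ tabulate f
toList-tabulate {m = zero} f = refl
toList-tabulate {m = suc m} f = cong (f Fin.zero ∷_) (toList-tabulate (f ∘ Fin.suc))

listEqᵇ-sound : ∀ xs ys → T (listEqᵇ xs ys) → xs ≡ ys
listEqᵇ-sound [] [] _ = refl
listEqᵇ-sound (x ∷ xs) (y ∷ ys) t = let x≡y , xs≡ys = ∧-elim t in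
  cong₂ _∷_ (ℕ.≡ᵇ⇒≡ x y x≡y) (listEqᵇ-sound xs ys xs≡ys)

listEqᵇ-refl : ∀ xs → T (listEqᵇ xs xs)
listEqᵇ-refl [] = _
listEqᵇ-refl (x ∷ xs) = ∧-intro (ℕ.≡⇒≡ᵇ x x refl) (listEqᵇ-refl xs)

listEqᵇ-toList-sound : ∀ {k} (A B : Vec ℕ k) → T (listEqᵇ (toList A) (toList B)) → A ≡ B
listEqᵇ-toList-sound A B t =
  ≡.trans (≡.sym (cast-is-id refl A)) (Vec.toList-injective refl A B (listEqᵇ-sound (toList A) (toList B) t))

≤ᵇ-suc : ∀ m n → (suc m ≤ᵇ suc n) ≡ (m ≤ᵇ n)
≤ᵇ-suc zero n = refl
≤ᵇ-suc (suc m) n = refl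

+-≤ᵇ-cancelˡ : ∀ m n o → (m + n ≤ᵇ m + o) ≡ (n ≤ᵇ o)
+-≤ᵇ-cancelˡ zero n o = refl
+-≤ᵇ-cancelˡ (suc m) n o = ≡.trans (≤ᵇ-suc (m + n) (m + o)) (+-≤ᵇ-cancelˡ m n o)

1+m+n≡ᵇm : ∀ m n → (suc m + n ≡ᵇ m) ≡ false
1+m+n≡ᵇm zero n = refl
1+m+n≡ᵇm (suc m) n = 1+m+n≡ᵇm m n

+-≡ᵇ-cancelˡ : ∀ m n o → (m + n ≡ᵇ m + o) ≡ (n ≡ᵇ o)
+-≡ᵇ-cancelˡ zero n o = refl
+-≡ᵇ-cancelˡ (suc m) n o = +-≡ᵇ-cancelˡ m n o

<ᵇ-zero : ∀ n → (n <ᵇ 0) ≡ false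
<ᵇ-zero zero = refl
<ᵇ-zero (suc n) = refl

module _ {m : ℕ} (p : Fin m → Bool) where

  allB-intro : (∀ i → T (p i)) → T (allB p)
  allB-intro h = all⁻ p (tabulate⁺ h)

  allB-elim : T (allB p) → ∀ i → T (p i)
  allB-elim t i = All.lookup (all⁺ p (allFin m) t) (∈-allFin i)

  anyB-intro : ∀ i → T (p i) → T (anyB p)
  anyB-intro i t = any⁺ p (lose (∈-allFin i) t)

  anyB-elim : T (anyB p) → ∃ λ i → T (p i)
  anyB-elim t = Any.satisfied (any⁻ p (allFin m) t)

module _ {m : ℕ} {p q : Fin m → Bool} (p≗q : p ≗ q) where

  anyB-cong : anyB p ≡ anyB q
  anyB-cong = cong or (List.map-cong p≗q (allFin m))

  countB-cong : countB p ≡ countB q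
  countB-cong = cong length (filterᵇ-cong p≗q (allFin m))

allB-suc : ∀ {m} (p : Fin (suc m) → Bool) → allB p ≡ p Fin.zero ∧ allB (p ∘ Fin.suc)
allB-suc {m} p = cong (λ bs → p Fin.zero ∧ and bs)
  (≡.trans (List.map-tabulate Fin.suc p) (≡.sym (List.map-tabulate id (p ∘ Fin.suc))))

anyB-suc : ∀ {m} (p : Fin (suc m) → Bool) → anyB p ≡ p Fin.zero ∨ anyB (p ∘ Fin.suc)
anyB-suc {m} p = cong (λ bs → p Fin.zero ∨ or bs)
  (≡.trans (List.map-tabulate Fin.suc p) (≡.sym (List.map-tabulate id (p ∘ Fin.suc))))

anyB-none : ∀ {m} {p : Fin m → Bool} → (∀ i → ¬ T (p i)) → anyB p ≡ false
anyB-none {p = p} none with T? (anyB p)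
... | yes t = let i , pᵢ = anyB-elim p t in ⊥-elim (none i pᵢ)
... | no ¬t = ¬T⇒≡false ¬t

filterᵇ-allFin-⊆ : ∀ {m} {p q : Fin m → Bool} → filterᵇ p (allFin m) ≡ filterᵇ q (allFin m) →
                   ∀ {i} → T (p i) → T (q i)
filterᵇ-allFin-⊆ {m} {p} {q} eq {i} t =
  proj₂ (∈-filter⁻ (T? ∘ q) {xs = allFin m} (≡.subst (i ∈_) eq (∈-filter⁺ (T? ∘ p) (∈-allFin i) t)))

countB-suc : ∀ {m} (p : Fin (suc m) → Bool) → countB p ≡ bit (p Fin.zero) + countB (p ∘ Fin.suc)
countB-suc {m} p =
  ≡.trans (length-filterᵇ-∷ p Fin.zero (tabulate Fin.suc)) (cong (bit (p Fin.zero) +_) countB-tail)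
  where
  countB-tail : length (filterᵇ p (tabulate Fin.suc)) ≡ countB (p ∘ Fin.suc)
  countB-tail = begin
    length (filterᵇ p (tabulate Fin.suc))                    ≡⟨ cong (length ∘ filterᵇ p) (List.map-tabulate id Fin.suc) ⟨
    length (filterᵇ p (map Fin.suc (allFin m)))              ≡⟨ cong length (filterᵇ-map p Fin.suc (allFin m)) ⟩
    length (map Fin.suc (filterᵇ (p ∘ Fin.suc) (allFin m)))  ≡⟨ List.length-map Fin.suc (filterᵇ (p ∘ Fin.suc) (allFin m)) ⟩
    countB (p ∘ Fin.suc)                                     ∎
    where open ≡.≡-Reasoning

countB-split : ∀ {m} (q p : Fin m → Bool) →
               countB p ≡ countB (λ j → q j ∧ p j) + countB (λ j → not (q j) ∧ p j)
countB-split {zero} q p = refl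
countB-split {suc m} q p = begin
  countB p                                                    ≡⟨ countB-suc p ⟩
  bit (p Fin.zero) + countB (p ∘ Fin.suc)                     ≡⟨ cong₂ _+_ (bit-split (q Fin.zero) (p Fin.zero))
                                                                           (countB-split (q ∘ Fin.suc) (p ∘ Fin.suc)) ⟩
  (bit (both Fin.zero) + bit (only Fin.zero)) + (countB (both ∘ Fin.suc) + countB (only ∘ Fin.suc))
                                                              ≡⟨ +-interchange (bit (both Fin.zero)) (bit (only Fin.zero)) _ _ ⟩
  (bit (both Fin.zero) + countB (both ∘ Fin.suc)) + (bit (only Fin.zero) + countB (only ∘ Fin.suc))
                                                              ≡⟨ cong₂ _+_ (countB-suc both) (countB-suc only) ⟨
  countB both + countB only                                   ∎
  where
  open ≡.≡-Reasoning
  both only : Fin (suc m) → Bool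
  both j = q j ∧ p j
  only j = not (q j) ∧ p j
  bit-split : ∀ a b → bit b ≡ bit (a ∧ b) + bit (not a ∧ b)
  bit-split true b = ≡.sym (ℕ.+-identityʳ (bit b))
  bit-split false b = refl

countB-≤ : ∀ {m} (p : Fin m → Bool) → countB p ≤ m
countB-≤ {m} p = ℕ.≤-trans (List.length-filter (T? ∘ p) (allFin m)) (ℕ.≤-reflexive (List.length-tabulate id))

countB-pos : ∀ {m} (p : Fin m → Bool) i → T (p i) → 0 < countB p
countB-pos p i t = List.filter-some (T? ∘ p) (lose (∈-allFin i) t)

countB-false : ∀ m → countB {m} (λ _ → false) ≡ 0
countB-false m = cong length (List.filter-none (T? ∘ λ _ → false) (tabulate⁺ {n = m} (λ _ ())))

countB-≟ : ∀ {m} (c : Fin m) → countB (λ j → does (j Fin.≟ c)) ≡ 1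
countB-≟ {suc m} Fin.zero = ≡.trans (countB-suc {m} (λ j → does (j Fin.≟ Fin.zero))) (cong suc (countB-false m))
countB-≟ {suc m} (Fin.suc c) = ≡.trans (countB-suc {m} (λ j → does (j Fin.≟ Fin.suc c))) (countB-≟ c)

module Sums {c ℓ} (S : CommutativeSemiring c ℓ) where

  open CommutativeSemiring S renaming (refl to ≈-refl; _+_ to _⊕_; _*_ to _⊗_)
  open SemiringOps S public
  open import Relation.Binary.Reasoning.Setoid setoid
  open import Algebra.Properties.CommutativeSemigroup +-commutativeSemigroup using ()
    renaming (interchange to ⊕-interchange)
  open import Algebra.Properties.CommutativeSemigroup *-commutativeSemigroup using ()
    renaming (interchange to ⊗-interchange)

  𝟙 : Bool → Carrier
  𝟙 b = if b then 1# else 0#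

  𝟙-∧ : ∀ a b → 𝟙 (a ∧ b) ≈ 𝟙 a ⊗ 𝟙 b
  𝟙-∧ true b = sym (*-identityˡ _)
  𝟙-∧ false b = sym (zeroˡ _)

  𝟙-accept : ∀ {b} x → T b → 𝟙 b ⊗ x ≈ x
  𝟙-accept {true} x _ = *-identityˡ x

  𝟙-reject : ∀ {b} x → ¬ T b → 𝟙 b ⊗ x ≈ 0#
  𝟙-reject {true} x ¬t = ⊥-elim (¬t _)
  𝟙-reject {false} x _ = zeroˡ x

  𝟙-*-cong : ∀ {b y z} → (T b → y ≈ z) → 𝟙 b ⊗ y ≈ 𝟙 b ⊗ z
  𝟙-*-cong {true} y≈z = *-cong ≈-refl (y≈z _)
  𝟙-*-cong {false} _ = trans (zeroˡ _) (sym (zeroˡ _))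

  𝟙-𝟙-reject : ∀ {a b} y → (T a → T b → ⊥) → 𝟙 a ⊗ (𝟙 b ⊗ y) ≈ 0#
  𝟙-𝟙-reject {true} {true} y ¬ab = ⊥-elim (¬ab _ _)
  𝟙-𝟙-reject {true} {false} y _ = trans (*-identityˡ _) (zeroˡ y)
  𝟙-𝟙-reject {false} y _ = zeroˡ _

  ∑L-cong : ∀ (xs : List A) {f g : A → Carrier} → (∀ a → f a ≈ g a) → ∑L xs f ≈ ∑L xs g
  ∑L-cong [] f≈g = ≈-refl
  ∑L-cong (x ∷ xs) f≈g = +-cong (f≈g x) (∑L-cong xs f≈g)

  ∑L-++ : ∀ (xs ys : List A) f → ∑L (xs ++ ys) f ≈ ∑L xs f ⊕ ∑L ys f
  ∑L-++ [] ys f = sym (+-identityˡ _)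
  ∑L-++ (x ∷ xs) ys f = trans (+-cong ≈-refl (∑L-++ xs ys f)) (sym (+-assoc _ _ _))

  ∑L-map : ∀ (h : A → B) xs f → ∑L (map h xs) f ≡ ∑L xs (f ∘ h)
  ∑L-map h [] f = refl
  ∑L-map h (x ∷ xs) f = cong (f (h x) ⊕_) (∑L-map h xs f)

  ∑L-concatMap : ∀ (h : A → List B) xs f → ∑L (concatMap h xs) f ≈ ∑L xs (λ a → ∑L (h a) f)
  ∑L-concatMap h [] f = ≈-refl
  ∑L-concatMap h (x ∷ xs) f = trans (∑L-++ (h x) (concatMap h xs) f) (+-cong ≈-refl (∑L-concatMap h xs f))

  ∑L-zero : ∀ (xs : List A) → ∑L xs (λ _ → 0#) ≈ 0#
  ∑L-zero [] = ≈-refl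
  ∑L-zero (x ∷ xs) = trans (+-identityˡ _) (∑L-zero xs)

  ∑L-+ : ∀ (xs : List A) f g → ∑L xs (λ a → f a ⊕ g a) ≈ ∑L xs f ⊕ ∑L xs g
  ∑L-+ [] f g = sym (+-identityˡ _)
  ∑L-+ (x ∷ xs) f g = trans (+-cong ≈-refl (∑L-+ xs f g)) (⊕-interchange _ _ _ _)

  *-distribˡ-∑L : ∀ (xs : List A) y f → y ⊗ ∑L xs f ≈ ∑L xs (λ a → y ⊗ f a)
  *-distribˡ-∑L [] y f = zeroʳ y
  *-distribˡ-∑L (x ∷ xs) y f = trans (distribˡ y _ _) (+-cong ≈-refl (*-distribˡ-∑L xs y f))

  *-distribʳ-∑L : ∀ (xs : List A) y f → ∑L xs f ⊗ y ≈ ∑L xs (λ a → f a ⊗ y)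
  *-distribʳ-∑L [] y f = zeroˡ y
  *-distribʳ-∑L (x ∷ xs) y f = trans (distribʳ y _ _) (+-cong ≈-refl (*-distribʳ-∑L xs y f))

  ∑L-comm : ∀ (xs : List A) (ys : List B) (f : A → B → Carrier) →
            ∑L xs (λ a → ∑L ys (f a)) ≈ ∑L ys (λ b → ∑L xs (λ a → f a b))
  ∑L-comm [] ys f = sym (∑L-zero ys)
  ∑L-comm (x ∷ xs) ys f = trans (+-cong ≈-refl (∑L-comm xs ys f)) (sym (∑L-+ ys (f x) (λ b → ∑L xs (λ a → f a b))))

  ∑L-filterᵇ : ∀ (p : A → Bool) xs f → ∑L (filterᵇ p xs) f ≈ ∑L xs (λ a → 𝟙 (p a) ⊗ f a)
  ∑L-filterᵇ p [] f = ≈-refl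
  ∑L-filterᵇ p (x ∷ xs) f with p x
  ... | true = +-cong (sym (*-identityˡ _)) (∑L-filterᵇ p xs f)
  ... | false = trans (sym (+-identityˡ _)) (+-cong (sym (zeroˡ _)) (∑L-filterᵇ p xs f))

  natMul-length : ∀ (xs : List A) y → natMul (length xs) y ≡ ∑L xs (λ _ → y)
  natMul-length [] y = refl
  natMul-length (x ∷ xs) y = cong (y ⊕_) (natMul-length xs y)

  ∑L-tabulate : ∀ {m} (h : Fin m → A) f → ∑L (tabulate h) f ≡ ∑ (f ∘ h)
  ∑L-tabulate {m = zero} h f = refl
  ∑L-tabulate {m = suc m} h f = cong (f (h Fin.zero) ⊕_) (∑L-tabulate (h ∘ Fin.suc) f)

  ∑-cong : ∀ {m} {f g : Fin m → Carrier} → (∀ i → f i ≈ g i) → ∑ f ≈ ∑ g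
  ∑-cong {zero} f≈g = ≈-refl
  ∑-cong {suc m} f≈g = +-cong (f≈g Fin.zero) (∑-cong (f≈g ∘ Fin.suc))

  ∑-zero : ∀ m → ∑ {m} (λ _ → 0#) ≈ 0#
  ∑-zero zero = ≈-refl
  ∑-zero (suc m) = trans (+-identityˡ _) (∑-zero m)

  ∑-+ : ∀ {m} (f g : Fin m → Carrier) → ∑ (λ i → f i ⊕ g i) ≈ ∑ f ⊕ ∑ g
  ∑-+ {zero} f g = sym (+-identityˡ _)
  ∑-+ {suc m} f g = trans (+-cong ≈-refl (∑-+ (f ∘ Fin.suc) (g ∘ Fin.suc))) (⊕-interchange _ _ _ _)

  ∑-δ : ∀ {m} (t : Fin m) → ∑ (λ a → 𝟙 (does (t Fin.≟ a))) ≈ 1#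
  ∑-δ {suc m} Fin.zero = trans (+-cong ≈-refl (∑-zero m)) (+-identityʳ _)
  ∑-δ {suc m} (Fin.suc t) = trans (+-identityˡ _) (∑-δ t)

  ∏-cong : ∀ {m} {f g : Fin m → Carrier} → (∀ i → f i ≈ g i) → ∏ f ≈ ∏ g
  ∏-cong {zero} f≈g = ≈-refl
  ∏-cong {suc m} f≈g = *-cong (f≈g Fin.zero) (∏-cong (f≈g ∘ Fin.suc))

  ∏-1 : ∀ m → ∏ {m} (λ _ → 1#) ≈ 1#
  ∏-1 zero = ≈-refl
  ∏-1 (suc m) = trans (*-identityˡ _) (∏-1 m)

  ∏-* : ∀ {m} (f g : Fin m → Carrier) → ∏ (λ i → f i ⊗ g i) ≈ ∏ f ⊗ ∏ g
  ∏-* {zero} f g = sym (*-identityˡ _)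
  ∏-* {suc m} f g = trans (*-cong ≈-refl (∏-* (f ∘ Fin.suc) (g ∘ Fin.suc))) (⊗-interchange _ _ _ _)

  ∏-+ : ∀ m {n} (f : Fin (m + n) → Carrier) → ∏ f ≈ ∏ (λ i → f (i ↑ˡ n)) ⊗ ∏ (λ i → f (m ↑ʳ i))
  ∏-+ zero f = sym (*-identityˡ _)
  ∏-+ (suc m) f = trans (*-cong ≈-refl (∏-+ m (f ∘ Fin.suc))) (sym (*-assoc _ _ _))

  pow-+ : ∀ x a b → pow x (a + b) ≈ pow x a ⊗ pow x b
  pow-+ x zero b = sym (*-identityˡ _)
  pow-+ x (suc a) b = trans (*-cong ≈-refl (pow-+ x a b)) (sym (*-assoc _ _ _))

  pow-cong : ∀ {x y} e → x ≈ y → pow x e ≈ pow y e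
  pow-cong zero x≈y = ≈-refl
  pow-cong (suc e) x≈y = *-cong x≈y (pow-cong e x≈y)

  ∑L-allFuns-∏ : ∀ (xs : List A) m (h : Fin m → A → Carrier) →
                 ∑L (allFuns xs m) (λ f → ∏ (λ i → h i (f i))) ≈ ∏ (λ i → ∑L xs (h i))
  ∑L-allFuns-∏ xs zero h = +-identityʳ _
  ∑L-allFuns-∏ xs (suc m) h = begin
    ∑L (allFuns xs (suc m)) F
      ≈⟨ ∑L-concatMap _ xs F ⟩
    ∑L xs (λ a → ∑L (map _ (allFuns xs m)) F)
      ≈⟨ ∑L-cong xs (λ a → reflexive (∑L-map _ (allFuns xs m) F)) ⟩
    ∑L xs (λ a → ∑L (allFuns xs m) (λ f → h Fin.zero a ⊗ ∏ (λ i → h (Fin.suc i) (f i))))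
      ≈⟨ ∑L-cong xs (λ a → trans (sym (*-distribˡ-∑L (allFuns xs m) (h Fin.zero a) _))
                                 (*-cong ≈-refl (∑L-allFuns-∏ xs m (h ∘ Fin.suc)))) ⟩
    ∑L xs (λ a → h Fin.zero a ⊗ ∏ (λ i → ∑L xs (h (Fin.suc i))))
      ≈⟨ sym (*-distribʳ-∑L xs _ (h Fin.zero)) ⟩
    ∑L xs (h Fin.zero) ⊗ ∏ (λ i → ∑L xs (h (Fin.suc i))) ∎
    where
    F : (Fin (suc m) → _) → Carrier
    F f = ∏ (λ i → h i (f i))

  ∑L-allVecs-∏ : ∀ (xs : List A) m (h : Fin m → A → Carrier) →
                 ∑L (allVecs xs m) (λ v → ∏ (λ i → h i (lookup v i))) ≈ ∏ (λ i → ∑L xs (h i))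
  ∑L-allVecs-∏ xs zero h = +-identityʳ _
  ∑L-allVecs-∏ xs (suc m) h = begin
    ∑L (allVecs xs (suc m)) F
      ≈⟨ ∑L-concatMap _ xs F ⟩
    ∑L xs (λ a → ∑L (map (a Vec.∷_) (allVecs xs m)) F)
      ≈⟨ ∑L-cong xs (λ a → reflexive (∑L-map (a Vec.∷_) (allVecs xs m) F)) ⟩
    ∑L xs (λ a → ∑L (allVecs xs m) (λ v → h Fin.zero a ⊗ ∏ (λ i → h (Fin.suc i) (lookup v i))))
      ≈⟨ ∑L-cong xs (λ a → trans (sym (*-distribˡ-∑L (allVecs xs m) (h Fin.zero a) _))
                                 (*-cong ≈-refl (∑L-allVecs-∏ xs m (h ∘ Fin.suc)))) ⟩
    ∑L xs (λ a → h Fin.zero a ⊗ ∏ (λ i → ∑L xs (h (Fin.suc i))))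
      ≈⟨ sym (*-distribʳ-∑L xs _ (h Fin.zero)) ⟩
    ∑L xs (h Fin.zero) ⊗ ∏ (λ i → ∑L xs (h (Fin.suc i))) ∎
    where
    F : Vec _ (suc m) → Carrier
    F v = ∏ (λ i → h i (lookup v i))

  ∏-𝟙 : ∀ {m} (p : Fin m → Bool) → ∏ (λ i → 𝟙 (p i)) ≈ 𝟙 (allB p)
  ∏-𝟙 {zero} p = ≈-refl
  ∏-𝟙 {suc m} p = begin
    𝟙 (p Fin.zero) ⊗ ∏ (λ i → 𝟙 (p (Fin.suc i))) ≈⟨ *-cong ≈-refl (∏-𝟙 (p ∘ Fin.suc)) ⟩
    𝟙 (p Fin.zero) ⊗ 𝟙 (allB (p ∘ Fin.suc))      ≈⟨ 𝟙-∧ (p Fin.zero) _ ⟨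
    𝟙 (p Fin.zero ∧ allB (p ∘ Fin.suc))          ≡⟨ cong 𝟙 (allB-suc p) ⟨
    𝟙 (allB p)                                   ∎

module ℕ-Sums = Sums ℕ.+-*-commutativeSemiring

sum-tabulate : ∀ {m} (f : Fin m → ℕ) → Vec.sum (Vec.tabulate f) ≡ ℕ-Sums.∑ f
sum-tabulate {zero} f = refl
sum-tabulate {suc m} f = cong (f Fin.zero +_) (sum-tabulate (f ∘ Fin.suc))

∑-countB-fibres : ∀ {m k} (g : Fin m → Fin k) → ℕ-Sums.∑ (λ s → countB (λ e → does (g e Fin.≟ s))) ≡ m
∑-countB-fibres {zero} {k} g = ℕ-Sums.∑-zero k
∑-countB-fibres {suc m} g = begin
  ∑ (λ s → countB (λ e → does (g e Fin.≟ s)))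
    ≡⟨ ∑-cong (λ s → countB-suc (λ e → does (g e Fin.≟ s))) ⟩
  ∑ (λ s → bit (does (g Fin.zero Fin.≟ s)) + countB (λ e → does (g (Fin.suc e) Fin.≟ s)))
    ≡⟨ ∑-+ (λ s → bit (does (g Fin.zero Fin.≟ s))) (λ s → countB (λ e → does (g (Fin.suc e) Fin.≟ s))) ⟩
  ∑ (λ s → bit (does (g Fin.zero Fin.≟ s))) + ∑ (λ s → countB (λ e → does (g (Fin.suc e) Fin.≟ s)))
    ≡⟨ cong₂ _+_ (∑-δ (g Fin.zero)) (∑-countB-fibres (g ∘ Fin.suc)) ⟩
  suc m ∎
  where
  open ≡.≡-Reasoning
  open ℕ-Sums using (∑; ∑-cong; ∑-+; ∑-δ)

-- Positions of the block maxima prescribed by J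

Positive : ∀ {k} → Vec ℕ k → Set
Positive J = ∀ s → 1 ≤ lookup J s

-- maxPos J s = m_s − 1: an element i ∈ {1,…,n} is represented by i − 1 : Fin n.
maxPos : ∀ {k} → Vec ℕ k → Fin k → ℕ
maxPos (j Vec.∷ J) Fin.zero = ℕ.pred j
maxPos (j Vec.∷ J) (Fin.suc s) = j + maxPos J s

isMax : ∀ {k} → Vec ℕ k → ℕ → Bool
isMax J e = anyB (λ s → e ≡ᵇ maxPos J s)

admissible : ∀ {k} → Vec ℕ k → ℕ → Fin k → Bool
admissible J e a = if isMax J e then e ≡ᵇ maxPos J a else e ≤ᵇ maxPos J a

Positive-tail : ∀ {k j} {J : Vec ℕ k} → Positive (j Vec.∷ J) → Positive J
Positive-tail pos = pos ∘ Fin.suc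

maxPos-< : ∀ {k} (J : Vec ℕ k) → Positive J → ∀ s → maxPos J s < Vec.sum J
maxPos-< (zero Vec.∷ J) pos s with () ← pos Fin.zero
maxPos-< (suc j Vec.∷ J) pos Fin.zero = s≤s (ℕ.m≤m+n j _)
maxPos-< (suc j Vec.∷ J) pos (Fin.suc s) = s≤s (ℕ.+-monoʳ-< j (maxPos-< J (Positive-tail pos) s))

maxPos-strictMono : ∀ {k} (J : Vec ℕ k) → Positive J → ∀ {s t} → toℕ s < toℕ t → maxPos J s < maxPos J t
maxPos-strictMono (zero Vec.∷ J) pos _ with () ← pos Fin.zero
maxPos-strictMono (suc j Vec.∷ J) pos {Fin.zero} {Fin.suc t} _ = s≤s (ℕ.m≤m+n j _)
maxPos-strictMono (suc j Vec.∷ J) pos {Fin.suc s} {Fin.suc t} (s≤s s<t) =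
  s≤s (ℕ.+-monoʳ-< j (maxPos-strictMono J (Positive-tail pos) s<t))

maxPos-injective : ∀ {k} (J : Vec ℕ k) → Positive J → ∀ {s t} → maxPos J s ≡ maxPos J t → s ≡ t
maxPos-injective J pos {s} {t} eq with ℕ.<-cmp (toℕ s) (toℕ t)
... | tri< s<t _ _ = ⊥-elim (ℕ.<⇒≢ (maxPos-strictMono J pos s<t) eq)
... | tri≈ _ s≡t _ = Fin.toℕ-injective s≡t
... | tri> _ _ t<s = ⊥-elim (ℕ.<⇒≢ (maxPos-strictMono J pos t<s) (≡.sym eq))

maxPos-head-≤ : ∀ {k} j (J : Vec ℕ k) a → j ≤ maxPos (suc j Vec.∷ J) a
maxPos-head-≤ j J Fin.zero = ℕ.≤-refl
maxPos-head-≤ j J (Fin.suc a) = ℕ.m≤n⇒m≤1+n (ℕ.m≤m+n j (maxPos J a))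

isMax-intro : ∀ {k} (J : Vec ℕ k) {e} s → e ≡ maxPos J s → T (isMax J e)
isMax-intro J {e} s e≡mₛ = anyB-intro (λ t → e ≡ᵇ maxPos J t) s (ℕ.≡⇒≡ᵇ e (maxPos J s) e≡mₛ)

isMax-elim : ∀ {k} (J : Vec ℕ k) e → T (isMax J e) → ∃ λ s → e ≡ maxPos J s
isMax-elim J e t = let s , e≡mₛ = anyB-elim (λ s → e ≡ᵇ maxPos J s) t in s , ℕ.≡ᵇ⇒≡ e (maxPos J s) e≡mₛ

isMax-head : ∀ {k} {j} (J : Vec ℕ k) {e} → e ≤ j → isMax (suc j Vec.∷ J) e ≡ (e ≡ᵇ j)
isMax-head {j = j} J {e} e≤j = begin
  isMax (suc j Vec.∷ J) e                            ≡⟨ anyB-suc (λ s → e ≡ᵇ maxPos (suc j Vec.∷ J) s) ⟩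
  (e ≡ᵇ j) ∨ anyB (λ s → e ≡ᵇ suc j + maxPos J s)    ≡⟨ cong ((e ≡ᵇ j) ∨_) (anyB-none beyond) ⟩
  (e ≡ᵇ j) ∨ false                                   ≡⟨ ∨-identityʳ _ ⟩
  (e ≡ᵇ j)                                           ∎
  where
  open ≡.≡-Reasoning
  beyond : ∀ s → ¬ T (e ≡ᵇ suc j + maxPos J s)
  beyond s t = ℕ.<⇒≢ (s≤s (ℕ.≤-trans e≤j (ℕ.m≤m+n j _))) (ℕ.≡ᵇ⇒≡ e _ t)

isMax-tail : ∀ {k} {j} (J : Vec ℕ k) e → isMax (suc j Vec.∷ J) (suc j + e) ≡ isMax J e
isMax-tail {j = j} J e = begin
  isMax (suc j Vec.∷ J) (suc j + e)
    ≡⟨ anyB-suc (λ s → suc j + e ≡ᵇ maxPos (suc j Vec.∷ J) s) ⟩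
  (suc j + e ≡ᵇ j) ∨ anyB (λ s → suc j + e ≡ᵇ suc j + maxPos J s)
    ≡⟨ cong₂ _∨_ (1+m+n≡ᵇm j e) (anyB-cong {q = λ s → e ≡ᵇ maxPos J s} (λ s → +-≡ᵇ-cancelˡ (suc j) e _)) ⟩
  false ∨ isMax J e
    ∎
  where
  open ≡.≡-Reasoning

ends : ∀ {k} → ℕ → Vec ℕ k → List ℕ
ends p J = tabulate (λ s → p + suc (maxPos J s))

ends-∷ : ∀ {k} p j (J : Vec ℕ k) → ends p (suc j Vec.∷ J) ≡ (p + suc j) ∷ ends (p + suc j) J
ends-∷ p j J = cong ((p + suc j) ∷_) (List.tabulate-cong shift)
  where
  shift : ∀ s → p + suc (suc j + maxPos J s) ≡ p + suc j + suc (maxPos J s)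
  shift s = ≡.trans (cong (p +_) (≡.sym (ℕ.+-suc (suc j) (maxPos J s)))) (≡.sym (ℕ.+-assoc p (suc j) _))

diffs-ends : ∀ {k} (J : Vec ℕ k) → Positive J → ∀ p → diffs p (ends p J) ≡ toList J
diffs-ends Vec.[] pos p = refl
diffs-ends (zero Vec.∷ J) pos p with () ← pos Fin.zero
diffs-ends (suc j Vec.∷ J) pos p = ≡.trans (cong (diffs p) (ends-∷ p j J))
  (cong₂ _∷_ (ℕ.m+n∸m≡n p (suc j)) (diffs-ends J (Positive-tail pos) (p + suc j)))

diffs≡⇒ends : ∀ {k} (J : Vec ℕ k) → Positive J → ∀ p L → diffs p L ≡ toList J → L ≡ ends p J
diffs≡⇒ends Vec.[] pos p [] eq = refl
diffs≡⇒ends (zero Vec.∷ J) pos p L eq with () ← pos Fin.zero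
diffs≡⇒ends (suc j Vec.∷ J) pos p (m ∷ L) eq = ≡.trans (cong₂ _∷_ m≡p+j tail) (≡.sym (ends-∷ p j J))
  where
  m∸p≡j : m ∸ p ≡ suc j
  m∸p≡j = List.∷-injectiveˡ eq
  p<m : p < m
  p<m = ℕ.m∸n≢0⇒n<m (λ m∸p≡0 → ℕ.0≢1+n (≡.trans (≡.sym m∸p≡0) m∸p≡j))
  m≡p+j : m ≡ p + suc j
  m≡p+j = ≡.trans (≡.sym (ℕ.m+[n∸m]≡n (ℕ.<⇒≤ p<m))) (cong (p +_) m∸p≡j)
  tail : L ≡ ends (p + suc j) J
  tail = ≡.subst (λ q → L ≡ ends q J) m≡p+j (diffs≡⇒ends J (Positive-tail pos) m L (List.∷-injectiveʳ eq))

filterᵇ-isMax-upTo : ∀ {k} (J : Vec ℕ k) → Positive J →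
                     filterᵇ (isMax J) (List.upTo (Vec.sum J)) ≡ tabulate (maxPos J)
filterᵇ-isMax-upTo Vec.[] pos = refl
filterᵇ-isMax-upTo (zero Vec.∷ J) pos with () ← pos Fin.zero
filterᵇ-isMax-upTo (suc j Vec.∷ J) pos = begin
  filterᵇ q (List.upTo (suc j + N))
    ≡⟨ cong (filterᵇ q) (applyUpTo-+ id (suc j) N) ⟩
  filterᵇ q (List.upTo (suc j) ++ List.applyUpTo (suc j +_) N)
    ≡⟨ List.filter-++ (T? ∘ q) (List.upTo (suc j)) _ ⟩
  filterᵇ q (List.upTo (suc j)) ++ filterᵇ q (List.applyUpTo (suc j +_) N)
    ≡⟨ cong₂ _++_ (filterᵇ-upTo-last q j (isMax-head J)) later ⟩
  j ∷ map (suc j +_) (tabulate (maxPos J))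
    ≡⟨ cong (j ∷_) (List.map-tabulate (maxPos J) (suc j +_)) ⟩
  tabulate (maxPos (suc j Vec.∷ J))
    ∎
  where
  open ≡.≡-Reasoning
  q : ℕ → Bool
  q = isMax (suc j Vec.∷ J)
  N : ℕ
  N = Vec.sum J
  later : filterᵇ q (List.applyUpTo (suc j +_) N) ≡ map (suc j +_) (tabulate (maxPos J))
  later = begin
    filterᵇ q (List.applyUpTo (suc j +_) N)          ≡⟨ cong (filterᵇ q) (List.map-upTo (suc j +_) N) ⟨
    filterᵇ q (map (suc j +_) (List.upTo N))         ≡⟨ filterᵇ-map q (suc j +_) (List.upTo N) ⟩
    map (suc j +_) (filterᵇ (q ∘ (suc j +_)) (List.upTo N))
      ≡⟨ cong (map (suc j +_)) (filterᵇ-cong (isMax-tail J) (List.upTo N)) ⟩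
    map (suc j +_) (filterᵇ (isMax J) (List.upTo N)) ≡⟨ cong (map (suc j +_)) (filterᵇ-isMax-upTo J (Positive-tail pos)) ⟩
    map (suc j +_) (tabulate (maxPos J))             ∎

-- Products of position weights

module PositionWeights {c ℓ} (S : CommutativeSemiring c ℓ) where

  open CommutativeSemiring S renaming (refl to ≈-refl; _+_ to _⊕_; _*_ to _⊗_)
  open Sums S
  open import Relation.Binary.Reasoning.Setoid setoid

  weight : ∀ {k} → Vec ℕ k → (Fin k → Carrier) → ℕ → Carrier
  weight J x e = if isMax J e then 1# else ∑ (λ a → 𝟙 (e ≤ᵇ maxPos J a) ⊗ x a)

  ∑-admissible : ∀ {k} (J : Vec ℕ k) → Positive J → ∀ x e →
                 ∑ (λ a → 𝟙 (admissible J e a) ⊗ (if isMax J e then 1# else x a)) ≈ weight J x e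
  ∑-admissible {k} J pos x e with T? (isMax J e)
  ... | no ¬max = trans (∑-cong term) (reflexive (≡.sym (if-¬T ¬max)))
    where
    term : ∀ a → 𝟙 (admissible J e a) ⊗ (if isMax J e then 1# else x a) ≈ 𝟙 (e ≤ᵇ maxPos J a) ⊗ x a
    term a = reflexive (cong₂ (λ b y → 𝟙 b ⊗ y) (if-¬T ¬max) (if-¬T ¬max))
  ... | yes max = begin
    ∑ (λ a → 𝟙 (admissible J e a) ⊗ (if isMax J e then 1# else x a))  ≈⟨ ∑-cong term ⟩
    ∑ (λ a → 𝟙 (does (s Fin.≟ a)))                                   ≈⟨ ∑-δ s ⟩
    1#                                                               ≡⟨ if-T max ⟨
    weight J x e                                                     ∎
    where
    s : Fin k
    s = proj₁ (isMax-elim J e max)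
    e≡mₛ : e ≡ maxPos J s
    e≡mₛ = proj₂ (isMax-elim J e max)
    at-max : ∀ a → (e ≡ᵇ maxPos J a) ≡ does (s Fin.≟ a)
    at-max a = T-⇔⇒≡
      (λ t → does-complete {d = s Fin.≟ a} (maxPos-injective J pos (≡.trans (≡.sym e≡mₛ) (ℕ.≡ᵇ⇒≡ _ _ t))))
      (λ t → ℕ.≡⇒≡ᵇ _ _ (≡.trans e≡mₛ (cong (maxPos J) (does-sound {d = s Fin.≟ a} t))))
    term : ∀ a → 𝟙 (admissible J e a) ⊗ (if isMax J e then 1# else x a) ≈ 𝟙 (does (s Fin.≟ a))
    term a = begin
      𝟙 (admissible J e a) ⊗ (if isMax J e then 1# else x a) ≡⟨ cong₂ (λ b y → 𝟙 b ⊗ y) (if-T max) (if-T max) ⟩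
      𝟙 (e ≡ᵇ maxPos J a) ⊗ 1#                               ≈⟨ *-identityʳ _ ⟩
      𝟙 (e ≡ᵇ maxPos J a)                                    ≡⟨ cong 𝟙 (at-max a) ⟩
      𝟙 (does (s Fin.≟ a))                                   ∎

  if-congᵉ : ∀ b {x y z : Carrier} → y ≈ z → (if b then x else y) ≈ (if b then x else z)
  if-congᵉ true y≈z = ≈-refl
  if-congᵉ false y≈z = y≈z

  weight-head : ∀ {k j} (J : Vec ℕ k) x {e} → e ≤ j →
                weight (suc j Vec.∷ J) x e ≈ (if e ≡ᵇ j then 1# else tailSum x Fin.zero)
  weight-head {j = j} J x {e} e≤j = trans (if-congᵉ (isMax (suc j Vec.∷ J) e) (∑-cong term))
                                          (reflexive (cong (λ b → if b then 1# else tailSum x Fin.zero) (isMax-head J e≤j)))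
    where
    term : ∀ a → 𝟙 (e ≤ᵇ maxPos (suc j Vec.∷ J) a) ⊗ x a ≈ x a
    term a = 𝟙-accept (x a) (ℕ.≤⇒≤ᵇ (ℕ.≤-trans e≤j (maxPos-head-≤ j J a)))

  weight-tail : ∀ {k j} (J : Vec ℕ k) x e → weight (suc j Vec.∷ J) x (suc j + e) ≈ weight J (x ∘ Fin.suc) e
  weight-tail {j = j} J x e = trans (if-congᵉ (isMax (suc j Vec.∷ J) (suc j + e)) tail-sum)
                                    (reflexive (cong (λ b → if b then 1# else _) (isMax-tail {j = j} J e)))
    where
    beyond-first : ¬ T (suc j + e ≤ᵇ j)
    beyond-first t = ℕ.<⇒≱ (s≤s (ℕ.m≤m+n j e)) (ℕ.≤ᵇ⇒≤ (suc j + e) j t)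
    tail-sum : 𝟙 (suc j + e ≤ᵇ j) ⊗ x Fin.zero ⊕ ∑ (λ a → 𝟙 (suc j + e ≤ᵇ suc j + maxPos J a) ⊗ x (Fin.suc a))
               ≈ ∑ (λ a → 𝟙 (e ≤ᵇ maxPos J a) ⊗ x (Fin.suc a))
    tail-sum = trans (+-cong (𝟙-reject _ beyond-first) (∑-cong shifted)) (+-identityˡ _)
      where
      shifted : ∀ a → 𝟙 (suc j + e ≤ᵇ suc j + maxPos J a) ⊗ x (Fin.suc a) ≈ 𝟙 (e ≤ᵇ maxPos J a) ⊗ x (Fin.suc a)
      shifted a = reflexive (cong (λ b → 𝟙 b ⊗ x (Fin.suc a)) (+-≤ᵇ-cancelˡ (suc j) e (maxPos J a)))

  tailSum-suc : ∀ {k} (x : Fin (suc k) → Carrier) s → tailSum x (Fin.suc s) ≈ tailSum (x ∘ Fin.suc) s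
  tailSum-suc x s = trans (+-cong (reflexive (cong (λ b → if b then x Fin.zero else 0#) (<ᵇ-zero (toℕ s)))) ≈-refl)
                          (trans (+-identityˡ _) (∑-cong shifted))
    where
    shifted : ∀ t → (if suc (toℕ s) ≤ᵇ suc (toℕ t) then x (Fin.suc t) else 0#)
                    ≈ (if toℕ s ≤ᵇ toℕ t then x (Fin.suc t) else 0#)
    shifted t = reflexive (cong (λ b → if b then x (Fin.suc t) else 0#) (≤ᵇ-suc (toℕ s) (toℕ t)))

  ∏-except-last : ∀ y j → ∏ {suc j} (λ i → if toℕ i ≡ᵇ j then 1# else y) ≈ pow y j
  ∏-except-last y zero = *-identityʳ 1#
  ∏-except-last y (suc j) = *-cong ≈-refl (∏-except-last y j)

  ∏-weight : ∀ {k} (J : Vec ℕ k) → Positive J → ∀ x →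
             ∏ {Vec.sum J} (λ e → weight J x (toℕ e)) ≈ ∏ (λ s → pow (tailSum x s) (lookup J s ∸ 1))
  ∏-weight Vec.[] pos x = ≈-refl
  ∏-weight (zero Vec.∷ J) pos x with () ← pos Fin.zero
  ∏-weight (suc j Vec.∷ J) pos x = begin
    ∏ {suc j + N} (λ e → w (toℕ e))
      ≈⟨ ∏-+ (suc j) (λ e → w (toℕ e)) ⟩
    ∏ {suc j} (λ i → w (toℕ (i ↑ˡ N))) ⊗ ∏ {N} (λ i → w (toℕ (suc j ↑ʳ i)))
      ≈⟨ *-cong first-block later-blocks ⟩
    pow (tailSum x Fin.zero) j ⊗ ∏ (λ s → pow (tailSum x (Fin.suc s)) (lookup J s ∸ 1))
      ∎
    where
    N : ℕ
    N = Vec.sum J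
    w : ℕ → Carrier
    w = weight (suc j Vec.∷ J) x
    first-block : ∏ {suc j} (λ i → w (toℕ (i ↑ˡ N))) ≈ pow (tailSum x Fin.zero) j
    first-block = trans (∏-cong {suc j} (λ i → trans (reflexive (cong w (Fin.toℕ-↑ˡ i N)))
                                                     (weight-head J x (Fin.toℕ≤pred[n] i))))
                        (∏-except-last (tailSum x Fin.zero) j)
    later-blocks : ∏ {N} (λ i → w (toℕ (suc j ↑ʳ i))) ≈ ∏ (λ s → pow (tailSum x (Fin.suc s)) (lookup J s ∸ 1))
    later-blocks = begin
      ∏ {N} (λ i → w (toℕ (suc j ↑ʳ i)))
        ≈⟨ ∏-cong {N} (λ i → trans (reflexive (cong w (Fin.toℕ-↑ʳ (suc j) i))) (weight-tail J x (toℕ i))) ⟩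
      ∏ {N} (λ i → weight J (x ∘ Fin.suc) (toℕ i))
        ≈⟨ ∏-weight J (Positive-tail pos) (x ∘ Fin.suc) ⟩
      ∏ (λ s → pow (tailSum (x ∘ Fin.suc) s) (lookup J s ∸ 1))
        ≈⟨ ∏-cong (λ s → pow-cong (lookup J s ∸ 1) (sym (tailSum-suc x s))) ⟩
      ∏ (λ s → pow (tailSum x (Fin.suc s)) (lookup J s ∸ 1))
        ∎

-- Block maxima of an equivalence relation

_≗₂_ : ∀ {n} → BRel n → BRel n → Set
R ≗₂ S = ∀ i j → R i j ≡ S i j

agreeᵇ : ∀ {n} → BRel n → BRel n → Fin n → Fin n → Bool
agreeᵇ R S i j = does (R i j Bool.≟ S i j)

_≐ᵇ_ : ∀ {n} → BRel n → BRel n → Bool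
R ≐ᵇ S = allB (λ i → allB (agreeᵇ R S i))

≐ᵇ-sound : ∀ {n} {R S : BRel n} → T (R ≐ᵇ S) → R ≗₂ S
≐ᵇ-sound {R = R} {S} t i j =
  does-sound {d = R i j Bool.≟ S i j} (allB-elim (agreeᵇ R S i) (allB-elim (allB ∘ agreeᵇ R S) t i) j)

≐ᵇ-complete : ∀ {n} {R S : BRel n} → R ≗₂ S → T (R ≐ᵇ S)
≐ᵇ-complete {R = R} {S} R≗S = allB-intro (allB ∘ agreeᵇ R S)
  (λ i → allB-intro (agreeᵇ R S i) (λ j → does-complete {d = R i j Bool.≟ S i j} (R≗S i j)))

module _ {n} (R : BRel n) where

  private
    reflexive-at : Fin n → Bool
    reflexive-at i = R i i
    symmetric-at : Fin n → Fin n → Bool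
    symmetric-at i j = not (R i j) ∨ R j i
    transitive-at : Fin n → Fin n → Fin n → Bool
    transitive-at i j l = not (R i j ∧ R j l) ∨ R i l
    reflexiveᵇ symmetricᵇ transitiveᵇ : Bool
    reflexiveᵇ = allB reflexive-at
    symmetricᵇ = allB (allB ∘ symmetric-at)
    transitiveᵇ = allB (λ i → allB (allB ∘ transitive-at i))

  isEquivᵇ-sound : T (isEquivᵇ R) → IsEquivalence (λ i j → T (R i j))
  isEquivᵇ-sound t = record
    { refl = λ {i} → allB-elim reflexive-at refl-t i
    ; sym = λ {i} {j} → implies-sound (allB-elim (symmetric-at i) (allB-elim (allB ∘ symmetric-at) sym-t i) j)
    ; trans = λ {i} {j} {l} Rij Rjl →
        implies-sound (allB-elim (transitive-at i j)
                        (allB-elim (allB ∘ transitive-at i) (allB-elim (λ i → allB (allB ∘ transitive-at i)) trans-t i) j) l)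
                      (∧-intro Rij Rjl)
    }
    where
    refl-t : T reflexiveᵇ
    refl-t = proj₁ (∧-elim t)
    sym-t : T symmetricᵇ
    sym-t = proj₁ (∧-elim {symmetricᵇ} (proj₂ (∧-elim {reflexiveᵇ} t)))
    trans-t : T transitiveᵇ
    trans-t = proj₂ (∧-elim {symmetricᵇ} (proj₂ (∧-elim {reflexiveᵇ} t)))

  isEquivᵇ-complete : IsEquivalence (λ i j → T (R i j)) → T (isEquivᵇ R)
  isEquivᵇ-complete eq = ∧-intro {reflexiveᵇ} refl-t (∧-intro {symmetricᵇ} sym-t trans-t)
    where
    open IsEquivalence eq using () renaming (refl to ∼-refl; sym to ∼-sym; trans to ∼-trans)
    refl-t : T reflexiveᵇ
    refl-t = allB-intro reflexive-at (λ i → ∼-refl)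
    sym-t : T symmetricᵇ
    sym-t = allB-intro (allB ∘ symmetric-at) (λ i → allB-intro (symmetric-at i) (λ j → implies-complete ∼-sym))
    trans-t : T transitiveᵇ
    trans-t = allB-intro (λ i → allB (allB ∘ transitive-at i)) (λ i → allB-intro (allB ∘ transitive-at i) (λ j →
                allB-intro (transitive-at i j) (λ l → implies-complete (uncurry ∼-trans ∘ ∧-elim))))

  isBlockMax-sound : ∀ {i j} → T (isBlockMax R i) → toℕ i < toℕ j → ¬ T (R i j)
  isBlockMax-sound {i} {j} max i<j Rij = T-not⇒¬T max (anyB-intro _ j (∧-intro (ℕ.<⇒<ᵇ i<j) Rij))

  isBlockMax-complete : ∀ {i} → (∀ j → toℕ i < toℕ j → ¬ T (R i j)) → T (isBlockMax R i)
  isBlockMax-complete {i} none = ¬T⇒T-not (λ t → let j , t′ = anyB-elim _ t ; i<j , Rij = ∧-elim t′ in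
                                                  none j (ℕ.<ᵇ⇒< _ _ i<j) Rij)

  ¬isBlockMax : ∀ {i} → ¬ T (isBlockMax R i) → ∃ λ j → toℕ i < toℕ j × T (R i j)
  ¬isBlockMax ¬max = let j , t = anyB-elim _ (¬T-not⇒T ¬max) ; i<j , Rij = ∧-elim t in j , ℕ.<ᵇ⇒< _ _ i<j , Rij

module BlockMaxima {n} (R : BRel n) (R-equiv : IsEquivalence (λ i j → T (R i j))) where

  open IsEquivalence R-equiv using () renaming (refl to ∼-refl; sym to ∼-sym; trans to ∼-trans)

  blockMax-above : ∀ i → ∃ λ μ → T (R i μ) × T (isBlockMax R μ)
  blockMax-above i = climb i (Fin.>-wellFounded i)
    where
    climb : ∀ i → Acc Fin._>_ i → ∃ λ μ → T (R i μ) × T (isBlockMax R μ)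
    climb i (acc later) with T? (isBlockMax R i)
    ... | yes max = i , ∼-refl , max
    ... | no ¬max = let j , i<j , Rij = ¬isBlockMax R ¬max
                        μ , Rjμ , max = climb j (later i<j)
                    in μ , ∼-trans Rij Rjμ , max

  blockMax-≤ : ∀ {i μ} → T (R i μ) → T (isBlockMax R μ) → toℕ i ≤ toℕ μ
  blockMax-≤ Riμ max = ℕ.≮⇒≥ (λ μ<i → isBlockMax-sound R max μ<i (∼-sym Riμ))

  blockMax-unique : ∀ {μ ν} → T (isBlockMax R μ) → T (isBlockMax R ν) → T (R μ ν) → μ ≡ ν
  blockMax-unique {μ} {ν} μ-max ν-max Rμν with ℕ.<-cmp (toℕ μ) (toℕ ν)
  ... | tri< μ<ν _ _ = ⊥-elim (isBlockMax-sound R μ-max μ<ν Rμν)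
  ... | tri≈ _ μ≡ν _ = Fin.toℕ-injective μ≡ν
  ... | tri> _ _ ν<μ = ⊥-elim (isBlockMax-sound R ν-max ν<μ (∼-sym Rμν))

  top : Fin n → Fin n
  top i = proj₁ (blockMax-above i)

  R-top : ∀ i → T (R i (top i))
  R-top i = proj₁ (proj₂ (blockMax-above i))

  top-max : ∀ i → T (isBlockMax R (top i))
  top-max i = proj₂ (proj₂ (blockMax-above i))

  R⇒top≡ : ∀ {i j} → T (R i j) → top i ≡ top j
  R⇒top≡ {i} {j} Rij = blockMax-unique (top-max i) (top-max j) (∼-trans (∼-sym (R-top i)) (∼-trans Rij (R-top j)))

  top≡⇒R : ∀ {i j} → top i ≡ top j → T (R i j)
  top≡⇒R {i} {j} eq = ∼-trans (R-top i) (≡.subst (λ μ → T (R μ j)) (≡.sym eq) (∼-sym (R-top j)))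

module _ {n} {R S : BRel n} (R≗S : R ≗₂ S) where

  IsEquivalence-resp : IsEquivalence (λ i j → T (S i j)) → IsEquivalence (λ i j → T (R i j))
  IsEquivalence-resp eq = record
    { refl = from ∼-refl
    ; sym = λ Rij → from (∼-sym (to Rij))
    ; trans = λ Rij Rjl → from (∼-trans (to Rij) (to Rjl))
    }
    where
    open IsEquivalence eq using () renaming (refl to ∼-refl; sym to ∼-sym; trans to ∼-trans)
    to : ∀ {i j} → T (R i j) → T (S i j)
    to {i} {j} = ≡.subst T (R≗S i j)
    from : ∀ {i j} → T (S i j) → T (R i j)
    from {i} {j} = ≡.subst T (≡.sym (R≗S i j))

  blockMaxima-cong : blockMaxima R ≡ blockMaxima S
  blockMaxima-cong = filterᵇ-cong (λ i → cong not (anyB-cong (λ j → cong (_ ∧_) (R≗S i j)))) (allFin n)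

  Cπ-cong : Cπ R ≡ Cπ S
  Cπ-cong = cong (λ ms → diffs 0 (map (λ m → suc (toℕ m)) ms)) blockMaxima-cong

  Kπ-cong : Kπ R ≡ Kπ S
  Kπ-cong = ≡.trans (List.map-cong (λ m → countB-cong (λ j → R≗S j m)) (blockMaxima R))
                    (cong (map (λ m → countB (λ j → S j m))) blockMaxima-cong)

-- Admissible labellings and set partitions with C(π) = J

module Labellings {k} (J : Vec ℕ k) (pos : Positive J) where

  n : ℕ
  n = Vec.sum J

  Labelling : Set
  Labelling = Fin n → Fin k

  kernel : Labelling → BRel n
  kernel g i j = does (g i Fin.≟ g j)

  kernel-sound : ∀ g {i j} → T (kernel g i j) → g i ≡ g j
  kernel-sound g {i} {j} = does-sound {d = g i Fin.≟ g j}

  kernel-complete : ∀ g {i j} → g i ≡ g j → T (kernel g i j)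
  kernel-complete g {i} {j} = does-complete {d = g i Fin.≟ g j}

  kernel-equiv : ∀ g → IsEquivalence (λ i j → T (kernel g i j))
  kernel-equiv g = record
    { refl = kernel-complete g refl
    ; sym = λ t → kernel-complete g (≡.sym (kernel-sound g t))
    ; trans = λ t u → kernel-complete g (≡.trans (kernel-sound g t) (kernel-sound g u))
    }

  Valid : Labelling → Set
  Valid g = ∀ e → T (admissible J (toℕ e) (g e))

  validᵇ : Labelling → Bool
  validᵇ g = allB (λ e → admissible J (toℕ e) (g e))

  validᵇ-sound : ∀ {g} → T (validᵇ g) → Valid g
  validᵇ-sound {g} = allB-elim (λ e → admissible J (toℕ e) (g e))

  validᵇ-complete : ∀ {g} → Valid g → T (validᵇ g)
  validᵇ-complete {g} = allB-intro (λ e → admissible J (toℕ e) (g e))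

  _≐ᶠ_ : Labelling → Labelling → Bool
  g ≐ᶠ h = allB (λ i → does (g i Fin.≟ h i))

  ≐ᶠ-sound : ∀ {g h} → T (g ≐ᶠ h) → ∀ i → g i ≡ h i
  ≐ᶠ-sound {g} {h} t i = does-sound {d = g i Fin.≟ h i} (allB-elim (λ i → does (g i Fin.≟ h i)) t i)

  ≐ᶠ-complete : ∀ {g h} → (∀ i → g i ≡ h i) → T (g ≐ᶠ h)
  ≐ᶠ-complete {g} {h} g≗h =
    allB-intro (λ i → does (g i Fin.≟ h i)) (λ i → does-complete {d = g i Fin.≟ h i} (g≗h i))

  maxFin : Fin k → Fin n
  maxFin s = Fin.fromℕ< (maxPos-< J pos s)

  toℕ-maxFin : ∀ s → toℕ (maxFin s) ≡ maxPos J s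
  toℕ-maxFin s = Fin.toℕ-fromℕ< (maxPos-< J pos s)

  maxima : List (Fin n)
  maxima = filterᵇ (isMax J ∘ toℕ) (allFin n)

  maxima≡tabulate : maxima ≡ tabulate maxFin
  maxima≡tabulate = List.map-injective Fin.toℕ-injective (begin
    map toℕ maxima                            ≡⟨ filterᵇ-map (isMax J) toℕ (allFin n) ⟨
    filterᵇ (isMax J) (map toℕ (allFin n))    ≡⟨ cong (filterᵇ (isMax J)) (List.map-tabulate {n = n} id toℕ) ⟩
    filterᵇ (isMax J) (tabulate {n = n} toℕ)  ≡⟨ cong (filterᵇ (isMax J)) (tabulate-toℕ id n) ⟩
    filterᵇ (isMax J) (List.upTo n)           ≡⟨ filterᵇ-isMax-upTo J pos ⟩
    tabulate (maxPos J)                       ≡⟨ List.tabulate-cong toℕ-maxFin ⟨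
    tabulate (toℕ ∘ maxFin)                   ≡⟨ List.map-tabulate maxFin toℕ ⟨
    map toℕ (tabulate maxFin)                 ∎)
    where open ≡.≡-Reasoning

  ends-maxima : map (λ m → suc (toℕ m)) maxima ≡ ends 0 J
  ends-maxima = begin
    map (λ m → suc (toℕ m)) maxima           ≡⟨ cong (map (λ m → suc (toℕ m))) maxima≡tabulate ⟩
    map (λ m → suc (toℕ m)) (tabulate maxFin) ≡⟨ List.map-tabulate maxFin (λ m → suc (toℕ m)) ⟩
    tabulate (λ s → suc (toℕ (maxFin s)))    ≡⟨ List.tabulate-cong (cong suc ∘ toℕ-maxFin) ⟩
    ends 0 J                                 ∎
    where open ≡.≡-Reasoning

  module _ {g : Labelling} (valid : Valid g) where

    valid-≤ : ∀ e → toℕ e ≤ maxPos J (g e)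
    valid-≤ e with T? (isMax J (toℕ e))
    ... | yes max = ℕ.≤-reflexive (ℕ.≡ᵇ⇒≡ _ _ (≡.subst T (if-T max) (valid e)))
    ... | no ¬max = ℕ.≤ᵇ⇒≤ _ _ (≡.subst T (if-¬T ¬max) (valid e))

    valid-max : ∀ {e} → T (isMax J (toℕ e)) → toℕ e ≡ maxPos J (g e)
    valid-max {e} max = ℕ.≡ᵇ⇒≡ _ _ (≡.subst T (if-T max) (valid e))

    valid-at-maxPos : ∀ {e s} → toℕ e ≡ maxPos J s → g e ≡ s
    valid-at-maxPos {e} {s} e≡mₛ = maxPos-injective J pos (≡.trans (≡.sym (valid-max (isMax-intro J s e≡mₛ))) e≡mₛ)

    valid-maxFin : ∀ s → g (maxFin s) ≡ s
    valid-maxFin s = valid-at-maxPos (toℕ-maxFin s)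

    isBlockMax-kernel : ∀ i → isBlockMax (kernel g) i ≡ isMax J (toℕ i)
    isBlockMax-kernel i = T-⇔⇒≡ to from
      where
      from : T (isMax J (toℕ i)) → T (isBlockMax (kernel g) i)
      from max = isBlockMax-complete (kernel g) λ j i<j same → ℕ.<⇒≱ i<j (begin
        toℕ j           ≤⟨ valid-≤ j ⟩
        maxPos J (g j)  ≡⟨ cong (maxPos J) (kernel-sound g same) ⟨
        maxPos J (g i)  ≡⟨ valid-max max ⟨
        toℕ i           ∎)
        where open ℕ.≤-Reasoning
      to : T (isBlockMax (kernel g) i) → T (isMax J (toℕ i))
      to bmax with T? (isMax J (toℕ i))
      ... | yes max = max
      ... | no ¬max = ⊥-elim (isBlockMax-sound (kernel g) bmax i<mᵢ (kernel-complete g (≡.sym (valid-maxFin (g i)))))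
        where
        i<mᵢ : toℕ i < toℕ (maxFin (g i))
        i<mᵢ = ≡.subst (toℕ i <_) (≡.sym (toℕ-maxFin (g i)))
                 (ℕ.≤∧≢⇒< (valid-≤ i) (¬max ∘ isMax-intro J (g i)))

    blockMaxima-kernel : blockMaxima (kernel g) ≡ maxima
    blockMaxima-kernel = filterᵇ-cong isBlockMax-kernel (allFin n)

    Cπ-kernel : Cπ (kernel g) ≡ toList J
    Cπ-kernel = ≡.trans (cong (λ ms → diffs 0 (map (λ m → suc (toℕ m)) ms)) blockMaxima-kernel)
                        (≡.trans (cong (diffs 0) ends-maxima) (diffs-ends J pos 0))

  blockSize : Labelling → Fin k → ℕ
  blockSize g s = countB (λ e → does (g e Fin.≟ s))

  blockSizes : Labelling → Vec ℕ k
  blockSizes g = Vec.tabulate (blockSize g)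

  Kπ-kernel : ∀ {g} → Valid g → Kπ (kernel g) ≡ toList (blockSizes g)
  Kπ-kernel {g} valid = begin
    map (λ m → countB (λ e → kernel g e m)) (blockMaxima (kernel g))
      ≡⟨ cong (map (λ m → countB (λ e → kernel g e m))) (≡.trans (blockMaxima-kernel valid) maxima≡tabulate) ⟩
    map (λ m → countB (λ e → kernel g e m)) (tabulate maxFin)
      ≡⟨ List.map-tabulate maxFin (λ m → countB (λ e → kernel g e m)) ⟩
    tabulate (blockSize g ∘ g ∘ maxFin)
      ≡⟨ List.tabulate-cong (cong (blockSize g) ∘ valid-maxFin valid) ⟩
    tabulate (blockSize g)
      ≡⟨ toList-tabulate (blockSize g) ⟨
    toList (blockSizes g) ∎
    where open ≡.≡-Reasoning

  sum-blockSizes : ∀ g → Vec.sum (blockSizes g) ≡ n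
  sum-blockSizes g = ≡.trans (sum-tabulate (blockSize g)) (∑-countB-fibres g)

  lookup-blockSizes : ∀ g s → lookup (blockSizes g) s ≡ blockSize g s
  lookup-blockSizes g = Vec.lookup∘tabulate (blockSize g)

  blockSize-bounds : ∀ {g} → Valid g → ∀ s → 1 ≤ lookup (blockSizes g) s × lookup (blockSizes g) s ≤ n
  blockSize-bounds {g} valid s rewrite lookup-blockSizes g s =
    countB-pos _ (maxFin s) (does-complete {d = g (maxFin s) Fin.≟ s} (valid-maxFin valid s)) , countB-≤ _

  blockSize-nonMax : ∀ {g} → Valid g → ∀ s →
                     lookup (blockSizes g) s ∸ 1 ≡ countB (λ e → not (isMax J (toℕ e)) ∧ does (g e Fin.≟ s))
  blockSize-nonMax {g} valid s = begin
    lookup (blockSizes g) s ∸ 1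
      ≡⟨ cong (_∸ 1) (lookup-blockSizes g s) ⟩
    blockSize g s ∸ 1
      ≡⟨ cong (_∸ 1) (countB-split (isMax J ∘ toℕ) (λ e → does (g e Fin.≟ s))) ⟩
    countB (λ e → isMax J (toℕ e) ∧ does (g e Fin.≟ s)) + nonMax ∸ 1
      ≡⟨ cong (λ c → c + nonMax ∸ 1) (≡.trans (countB-cong only-maxFin) (countB-≟ (maxFin s))) ⟩
    nonMax ∎
    where
    open ≡.≡-Reasoning
    nonMax : ℕ
    nonMax = countB (λ e → not (isMax J (toℕ e)) ∧ does (g e Fin.≟ s))
    only-maxFin : ∀ e → isMax J (toℕ e) ∧ does (g e Fin.≟ s) ≡ does (e Fin.≟ maxFin s)
    only-maxFin e = T-⇔⇒≡ to from
      where
      to : T (isMax J (toℕ e) ∧ does (g e Fin.≟ s)) → T (does (e Fin.≟ maxFin s))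
      to t = let max , gₑ≡s = ∧-elim t in
        does-complete {d = e Fin.≟ maxFin s} (Fin.toℕ-injective (begin
          toℕ e          ≡⟨ valid-max valid max ⟩
          maxPos J (g e) ≡⟨ cong (maxPos J) (does-sound {d = g e Fin.≟ s} gₑ≡s) ⟩
          maxPos J s     ≡⟨ toℕ-maxFin s ⟨
          toℕ (maxFin s) ∎))
      from : T (does (e Fin.≟ maxFin s)) → T (isMax J (toℕ e) ∧ does (g e Fin.≟ s))
      from t with does-sound {d = e Fin.≟ maxFin s} t
      ... | refl = ∧-intro (isMax-intro J s (toℕ-maxFin s)) (does-complete {d = g (maxFin s) Fin.≟ s} (valid-maxFin valid s))

  module FromPartition (R : BRel n) (R-equiv : IsEquivalence (λ i j → T (R i j))) (C≡J : Cπ R ≡ toList J) where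

    open BlockMaxima R R-equiv
    open IsEquivalence R-equiv using () renaming (sym to ∼-sym)

    blockMaxima≡maxima : blockMaxima R ≡ maxima
    blockMaxima≡maxima = List.map-injective (Fin.toℕ-injective ∘ ℕ.suc-injective)
                           (≡.trans (diffs≡⇒ends J pos 0 _ C≡J) (≡.sym ends-maxima))

    top-at-maxPos : ∀ i → ∃ λ s → toℕ (top i) ≡ maxPos J s
    top-at-maxPos i = isMax-elim J (toℕ (top i)) (filterᵇ-allFin-⊆ blockMaxima≡maxima (top-max i))

    label : Labelling
    label i = proj₁ (top-at-maxPos i)

    toℕ-top : ∀ i → toℕ (top i) ≡ maxPos J (label i)
    toℕ-top i = proj₂ (top-at-maxPos i)

    label-valid : Valid label
    label-valid e with T? (isMax J (toℕ e))
    ... | yes max = ≡.subst T (≡.sym (if-T max)) (ℕ.≡⇒≡ᵇ _ _ (≡.trans (cong toℕ (≡.sym top-e≡e)) (toℕ-top e)))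
      where
      top-e≡e : top e ≡ e
      top-e≡e = blockMax-unique (top-max e) (filterᵇ-allFin-⊆ (≡.sym blockMaxima≡maxima) max) (∼-sym (R-top e))
    ... | no ¬max = ≡.subst T (≡.sym (if-¬T ¬max))
                      (ℕ.≤⇒≤ᵇ (≡.subst (toℕ e ≤_) (toℕ-top e) (blockMax-≤ (R-top e) (top-max e))))

    top≡⇔label≡ : ∀ i j → top i ≡ top j ⇔ label i ≡ label j
    top≡⇔label≡ i j = mk⇔
      (λ eq → maxPos-injective J pos (≡.trans (≡.sym (toℕ-top i)) (≡.trans (cong toℕ eq) (toℕ-top j))))
      (λ eq → Fin.toℕ-injective (≡.trans (toℕ-top i) (≡.trans (cong (maxPos J) eq) (≡.sym (toℕ-top j)))))

    R≗kernel-label : R ≗₂ kernel label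
    R≗kernel-label i j = T-⇔⇒≡
      (kernel-complete label ∘ Equivalence.to (top≡⇔label≡ i j) ∘ R⇒top≡)
      (top≡⇒R ∘ Equivalence.from (top≡⇔label≡ i j) ∘ kernel-sound label)

    label-unique : ∀ {g} → Valid g → R ≗₂ kernel g → ∀ i → g i ≡ label i
    label-unique {g} valid R≗κ i =
      ≡.trans (kernel-sound g (≡.subst T (R≗κ i (top i)) (R-top i))) (valid-at-maxPos valid (toℕ-top i))

module Monomials {c ℓ} (S : CommutativeSemiring c ℓ) where

  open CommutativeSemiring S renaming (refl to ≈-refl; _+_ to _⊕_; _*_ to _⊗_)
  open Sums S
  open import Relation.Binary.Reasoning.Setoid setoid

  monomial : ∀ {k} → (Fin k → Carrier) → Vec ℕ k → Carrier
  monomial x I = ∏ (λ s → pow (x s) (lookup I s ∸ 1))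

  ∏-pow-δ : ∀ {k} (t : Fin k) (x : Fin k → Carrier) → ∏ (λ s → pow (x s) (bit (does (t Fin.≟ s)))) ≈ x t
  ∏-pow-δ {suc k} Fin.zero x = trans (*-cong (*-identityʳ _) (∏-1 k)) (*-identityʳ _)
  ∏-pow-δ (Fin.suc t) x = trans (*-identityˡ _) (∏-pow-δ t (x ∘ Fin.suc))

  ∏-pow-countB : ∀ {m k} (b : Fin m → Bool) (g : Fin m → Fin k) (x : Fin k → Carrier) →
                 ∏ (λ s → pow (x s) (countB (λ e → b e ∧ does (g e Fin.≟ s)))) ≈ ∏ (λ e → if b e then x (g e) else 1#)
  ∏-pow-countB {zero} {k} b g x = ∏-1 k
  ∏-pow-countB {suc m} {k} b g x = begin
    ∏ (λ s → pow (x s) (countB (λ e → b e ∧ does (g e Fin.≟ s))))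
      ≈⟨ ∏-cong (λ s → trans (reflexive (cong (pow (x s)) (countB-suc (λ e → b e ∧ does (g e Fin.≟ s)))))
                             (pow-+ (x s) (here s) (rest s))) ⟩
    ∏ (λ s → pow (x s) (here s) ⊗ pow (x s) (rest s))
      ≈⟨ ∏-* (λ s → pow (x s) (here s)) (λ s → pow (x s) (rest s)) ⟩
    ∏ (λ s → pow (x s) (here s)) ⊗ ∏ (λ s → pow (x s) (rest s))
      ≈⟨ *-cong (first (b Fin.zero)) (∏-pow-countB (b ∘ Fin.suc) (g ∘ Fin.suc) x) ⟩
    (if b Fin.zero then x (g Fin.zero) else 1#) ⊗ ∏ (λ e → if b (Fin.suc e) then x (g (Fin.suc e)) else 1#) ∎
    where
    here rest : Fin k → ℕ
    here s = bit (b Fin.zero ∧ does (g Fin.zero Fin.≟ s))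
    rest s = countB (λ e → b (Fin.suc e) ∧ does (g (Fin.suc e) Fin.≟ s))
    first : ∀ b₀ → ∏ (λ s → pow (x s) (bit (b₀ ∧ does (g Fin.zero Fin.≟ s)))) ≈ (if b₀ then x (g Fin.zero) else 1#)
    first true = ∏-pow-δ (g Fin.zero) x
    first false = ∏-1 k

  𝟙-listEqᵇ : ∀ {k} (A B : Vec ℕ k) → 𝟙 (listEqᵇ (toList A) (toList B)) ≈ ∏ (λ s → 𝟙 (lookup A s ≡ᵇ lookup B s))
  𝟙-listEqᵇ Vec.[] Vec.[] = ≈-refl
  𝟙-listEqᵇ (a Vec.∷ A) (b Vec.∷ B) = trans (𝟙-∧ (a ≡ᵇ b) _) (*-cong ≈-refl (𝟙-listEqᵇ A B))

  ∑-range-δ : ∀ n {b} → 1 ≤ b → b ≤ n → ∑L (map suc (List.upTo n)) (λ a → 𝟙 (b ≡ᵇ a)) ≈ 1#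
  ∑-range-δ n {suc b} _ b<n = begin
    ∑L (map suc (List.upTo n)) (λ a → 𝟙 (suc b ≡ᵇ a))
      ≡⟨ cong (λ as → ∑L as (λ a → 𝟙 (suc b ≡ᵇ a))) range≡ ⟩
    ∑L (tabulate {n = n} (suc ∘ toℕ)) (λ a → 𝟙 (suc b ≡ᵇ a))
      ≡⟨ ∑L-tabulate {m = n} (suc ∘ toℕ) (λ a → 𝟙 (suc b ≡ᵇ a)) ⟩
    ∑ {n} (λ a → 𝟙 (b ≡ᵇ toℕ a))
      ≈⟨ ∑-cong (λ a → reflexive (cong 𝟙 (at-b a))) ⟩
    ∑ (λ a → 𝟙 (does (t Fin.≟ a)))
      ≈⟨ ∑-δ t ⟩
    1# ∎
    where
    t : Fin n
    t = Fin.fromℕ< b<n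
    range≡ : map suc (List.upTo n) ≡ tabulate {n = n} (suc ∘ toℕ)
    range≡ = ≡.trans (List.map-upTo suc n) (≡.sym (tabulate-toℕ suc n))
    at-b : ∀ a → (b ≡ᵇ toℕ a) ≡ does (t Fin.≟ a)
    at-b a = T-⇔⇒≡
      (λ u → does-complete {d = t Fin.≟ a} (Fin.toℕ-injective (≡.trans (Fin.toℕ-fromℕ< b<n) (ℕ.≡ᵇ⇒≡ b (toℕ a) u))))
      (λ u → ℕ.≡⇒≡ᵇ b (toℕ a) (≡.trans (≡.sym (Fin.toℕ-fromℕ< b<n)) (cong toℕ (does-sound {d = t Fin.≟ a} u))))

  ∑-compositions-δ : ∀ {n k} (K : Vec ℕ k) → (∀ s → 1 ≤ lookup K s × lookup K s ≤ n) → Vec.sum K ≡ n →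
                     ∀ (f : Vec ℕ k → Carrier) →
                     ∑L (compositions n k) (λ I → 𝟙 (listEqᵇ (toList K) (toList I)) ⊗ f I) ≈ f K
  ∑-compositions-δ {n} {k} K bounds sum≡n f = begin
    ∑L (compositions n k) (λ I → δ I ⊗ f I)
      ≈⟨ ∑L-filterᵇ (λ v → Vec.sum v ≡ᵇ n) (allVecs parts k) (λ I → δ I ⊗ f I) ⟩
    ∑L (allVecs parts k) (λ I → 𝟙 (Vec.sum I ≡ᵇ n) ⊗ (δ I ⊗ f I)) ≈⟨ ∑L-cong (allVecs parts k) only-K ⟩
    ∑L (allVecs parts k) (λ I → δ I ⊗ f K)                   ≈⟨ *-distribʳ-∑L (allVecs parts k) (f K) δ ⟨
    ∑L (allVecs parts k) δ ⊗ f K                             ≈⟨ *-cong ∑-δ-K ≈-refl ⟩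
    1# ⊗ f K                                                 ≈⟨ *-identityˡ (f K) ⟩
    f K                                                      ∎
    where
    parts : List ℕ
    parts = map suc (List.upTo n)
    δ : Vec ℕ k → Carrier
    δ I = 𝟙 (listEqᵇ (toList K) (toList I))
    only-K : ∀ I → 𝟙 (Vec.sum I ≡ᵇ n) ⊗ (δ I ⊗ f I) ≈ δ I ⊗ f K
    only-K I with T? (listEqᵇ (toList K) (toList I))
    ... | no K≢I = trans (*-cong ≈-refl (𝟙-reject (f I) K≢I)) (trans (zeroʳ _) (sym (𝟙-reject (f K) K≢I)))
    ... | yes K≡I with listEqᵇ-toList-sound K I K≡I
    ...   | refl = 𝟙-accept _ (ℕ.≡⇒≡ᵇ _ _ sum≡n)
    ∑-δ-K : ∑L (allVecs parts k) δ ≈ 1#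
    ∑-δ-K = begin
      ∑L (allVecs parts k) δ
        ≈⟨ ∑L-cong (allVecs parts k) (𝟙-listEqᵇ K) ⟩
      ∑L (allVecs parts k) (λ I → ∏ (λ s → 𝟙 (lookup K s ≡ᵇ lookup I s)))
        ≈⟨ ∑L-allVecs-∏ parts k (λ s a → 𝟙 (lookup K s ≡ᵇ a)) ⟩
      ∏ (λ s → ∑L parts (λ a → 𝟙 (lookup K s ≡ᵇ a)))
        ≈⟨ ∏-cong (λ s → uncurry (∑-range-δ n) (bounds s)) ⟩
      ∏ {k} (λ _ → 1#)
        ≈⟨ ∏-1 k ⟩
      1# ∎

-- The generating function

module GeneratingFunction {c ℓ} (S : CommutativeSemiring c ℓ) {k} (J : Vec ℕ k) (pos : Positive J)
                          (x : Fin k → CommutativeSemiring.Carrier S) where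

  open CommutativeSemiring S renaming (refl to ≈-refl; _+_ to _⊕_; _*_ to _⊗_)
  open Sums S
  open Monomials S
  open PositionWeights S
  open Labellings J pos
  open import Relation.Binary.Reasoning.Setoid setoid

  monomialAt : List ℕ → Carrier
  monomialAt K = ∑L (compositions n k) (λ I → 𝟙 (listEqᵇ K (toList I)) ⊗ monomial x I)

  Kmonomial : BRel n → Carrier
  Kmonomial R = monomialAt (Kπ R)

  C≡Jᵇ : BRel n → Bool
  C≡Jᵇ R = listEqᵇ (Cπ R) (toList J)

  ∑-over-relations : ∑L (compositions n k) (λ I → natMul (cIJ n I J) (monomial x I))
                     ≈ ∑L (allRels n) (λ R → 𝟙 (isEquivᵇ R) ⊗ (𝟙 (C≡Jᵇ R) ⊗ Kmonomial R))
  ∑-over-relations = begin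
    ∑L comps (λ I → natMul (cIJ n I J) (monomial x I))
      ≈⟨ ∑L-cong comps count ⟩
    ∑L comps (λ I → ∑L (allRels n) (λ R → term R I))
      ≈⟨ ∑L-comm comps (allRels n) (λ I R → term R I) ⟩
    ∑L (allRels n) (λ R → ∑L comps (term R))
      ≈⟨ ∑L-cong (allRels n) factor ⟩
    ∑L (allRels n) (λ R → 𝟙 (isEquivᵇ R) ⊗ (𝟙 (C≡Jᵇ R) ⊗ Kmonomial R)) ∎
    where
    comps : List (Vec ℕ k)
    comps = compositions n k
    K≡Iᵇ : BRel n → Vec ℕ k → Bool
    K≡Iᵇ R I = listEqᵇ (Kπ R) (toList I)
    term : BRel n → Vec ℕ k → Carrier
    term R I = 𝟙 (isEquivᵇ R) ⊗ (𝟙 (K≡Iᵇ R I ∧ C≡Jᵇ R) ⊗ monomial x I)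
    count : ∀ I → natMul (cIJ n I J) (monomial x I) ≈ ∑L (allRels n) (λ R → term R I)
    count I = begin
      natMul (cIJ n I J) (monomial x I)
        ≡⟨ natMul-length (filterᵇ p (setPartitions n)) (monomial x I) ⟩
      ∑L (filterᵇ p (setPartitions n)) (λ _ → monomial x I)
        ≈⟨ ∑L-filterᵇ p (setPartitions n) (λ _ → monomial x I) ⟩
      ∑L (filterᵇ isEquivᵇ (allRels n)) (λ R → 𝟙 (p R) ⊗ monomial x I)
        ≈⟨ ∑L-filterᵇ isEquivᵇ (allRels n) (λ R → 𝟙 (p R) ⊗ monomial x I) ⟩
      ∑L (allRels n) (λ R → term R I) ∎
      where
      p : BRel n → Bool
      p R = K≡Iᵇ R I ∧ C≡Jᵇ R
    split : ∀ R I → 𝟙 (K≡Iᵇ R I ∧ C≡Jᵇ R) ⊗ monomial x I ≈ 𝟙 (C≡Jᵇ R) ⊗ (𝟙 (K≡Iᵇ R I) ⊗ monomial x I)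
    split R I = begin
      𝟙 (K≡Iᵇ R I ∧ C≡Jᵇ R) ⊗ monomial x I        ≈⟨ *-cong (𝟙-∧ (K≡Iᵇ R I) (C≡Jᵇ R)) ≈-refl ⟩
      (𝟙 (K≡Iᵇ R I) ⊗ 𝟙 (C≡Jᵇ R)) ⊗ monomial x I  ≈⟨ *-cong (*-comm _ _) ≈-refl ⟩
      (𝟙 (C≡Jᵇ R) ⊗ 𝟙 (K≡Iᵇ R I)) ⊗ monomial x I  ≈⟨ *-assoc _ _ _ ⟩
      𝟙 (C≡Jᵇ R) ⊗ (𝟙 (K≡Iᵇ R I) ⊗ monomial x I)  ∎
    factor : ∀ R → ∑L comps (term R) ≈ 𝟙 (isEquivᵇ R) ⊗ (𝟙 (C≡Jᵇ R) ⊗ Kmonomial R)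
    factor R = begin
      ∑L comps (term R)
        ≈⟨ ∑L-cong comps (λ I → *-cong ≈-refl (split R I)) ⟩
      ∑L comps (λ I → 𝟙 (isEquivᵇ R) ⊗ (𝟙 (C≡Jᵇ R) ⊗ (𝟙 (K≡Iᵇ R I) ⊗ monomial x I)))
        ≈⟨ *-distribˡ-∑L comps (𝟙 (isEquivᵇ R)) _ ⟨
      𝟙 (isEquivᵇ R) ⊗ ∑L comps (λ I → 𝟙 (C≡Jᵇ R) ⊗ (𝟙 (K≡Iᵇ R I) ⊗ monomial x I))
        ≈⟨ *-cong ≈-refl (*-distribˡ-∑L comps (𝟙 (C≡Jᵇ R)) _) ⟨
      𝟙 (isEquivᵇ R) ⊗ (𝟙 (C≡Jᵇ R) ⊗ Kmonomial R) ∎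

  labellings : List Labelling
  labellings = allFuns (allFin k) n

  ∑-≐ᵇ : ∀ S → ∑L (allRels n) (λ R → 𝟙 (R ≐ᵇ S)) ≈ 1#
  ∑-≐ᵇ S = begin
    ∑L (allRels n) (λ R → 𝟙 (R ≐ᵇ S))
      ≈⟨ ∑L-cong (allRels n) 𝟙-≐ᵇ ⟩
    ∑L (allRels n) (λ R → ∏ (λ i → ∏ (λ j → 𝟙 (agreeᵇ R S i j))))
      ≈⟨ ∑L-allFuns-∏ (allFuns bools n) n (λ i row → ∏ (λ j → 𝟙 (does (row j Bool.≟ S i j)))) ⟩
    ∏ (λ i → ∑L (allFuns bools n) (λ row → ∏ (λ j → 𝟙 (does (row j Bool.≟ S i j)))))
      ≈⟨ ∏-cong (λ i → ∑L-allFuns-∏ bools n (λ j b → 𝟙 (does (b Bool.≟ S i j)))) ⟩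
    ∏ (λ i → ∏ (λ j → ∑L bools (λ b → 𝟙 (does (b Bool.≟ S i j)))))
      ≈⟨ ∏-cong (λ i → trans (∏-cong (λ j → ∑-bools-δ (S i j))) (∏-1 n)) ⟩
    ∏ {n} (λ _ → 1#)
      ≈⟨ ∏-1 n ⟩
    1# ∎
    where
    bools : List Bool
    bools = true ∷ false ∷ []
    ∑-bools-δ : ∀ c → ∑L bools (λ b → 𝟙 (does (b Bool.≟ c))) ≈ 1#
    ∑-bools-δ true = trans (+-cong ≈-refl (+-identityˡ _)) (+-identityʳ _)
    ∑-bools-δ false = trans (+-identityˡ _) (+-identityʳ _)
    𝟙-≐ᵇ : ∀ R → 𝟙 (R ≐ᵇ S) ≈ ∏ (λ i → ∏ (λ j → 𝟙 (agreeᵇ R S i j)))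
    𝟙-≐ᵇ R = trans (sym (∏-𝟙 (allB ∘ agreeᵇ R S))) (∏-cong (λ i → sym (∏-𝟙 (agreeᵇ R S i))))

  ∑-≐ᶠ : ∀ g₀ → ∑L labellings (λ g → 𝟙 (g₀ ≐ᶠ g)) ≈ 1#
  ∑-≐ᶠ g₀ = begin
    ∑L labellings (λ g → 𝟙 (g₀ ≐ᶠ g))
      ≈⟨ ∑L-cong labellings (λ g → sym (∏-𝟙 (λ i → does (g₀ i Fin.≟ g i)))) ⟩
    ∑L labellings (λ g → ∏ (λ i → 𝟙 (does (g₀ i Fin.≟ g i))))
      ≈⟨ ∑L-allFuns-∏ (allFin k) n (λ i a → 𝟙 (does (g₀ i Fin.≟ a))) ⟩
    ∏ (λ i → ∑L (allFin k) (λ a → 𝟙 (does (g₀ i Fin.≟ a))))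
      ≈⟨ ∏-cong (λ i → trans (reflexive (∑L-tabulate id (λ a → 𝟙 (does (g₀ i Fin.≟ a))))) (∑-δ (g₀ i))) ⟩
    ∏ {n} (λ _ → 1#)
      ≈⟨ ∏-1 n ⟩
    1# ∎

  -- Relations are Boolean functions, so the bijection between partitions and labellings is used through
  -- pointwise-equality indicators: allRels lists every relation once up to ≗₂ (∑-≐ᵇ), and a partition
  -- with C(π) = J is ≗₂ the kernel of exactly one admissible labelling.
  labelledTerm : BRel n → Labelling → Carrier
  labelledTerm R g = 𝟙 (validᵇ g) ⊗ (𝟙 (R ≐ᵇ kernel g) ⊗ Kmonomial (kernel g))

  no-labelling : ∀ R → (∀ {g} → Valid g → R ≗₂ kernel g → ⊥) → ∑L labellings (labelledTerm R) ≈ 0#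
  no-labelling R none =
    trans (∑L-cong labellings (λ g → 𝟙-𝟙-reject _ (λ v R≐κ → none (validᵇ-sound v) (≐ᵇ-sound R≐κ))))
          (∑L-zero labellings)

  unique-labelling : ∀ R → T (isEquivᵇ R) → T (C≡Jᵇ R) → Kmonomial R ≈ ∑L labellings (labelledTerm R)
  unique-labelling R equiv C≡J = begin
    Kmonomial R                                         ≈⟨ *-identityˡ _ ⟨
    1# ⊗ Kmonomial R                                    ≈⟨ *-cong (∑-≐ᶠ label) ≈-refl ⟨
    ∑L labellings (λ g → 𝟙 (label ≐ᶠ g)) ⊗ Kmonomial R  ≈⟨ *-distribʳ-∑L labellings (Kmonomial R) (λ g → 𝟙 (label ≐ᶠ g)) ⟩
    ∑L labellings (λ g → 𝟙 (label ≐ᶠ g) ⊗ Kmonomial R)  ≈⟨ ∑L-cong labellings term ⟨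
    ∑L labellings (labelledTerm R)                      ∎
    where
    open FromPartition R (isEquivᵇ-sound R equiv) (listEqᵇ-sound _ _ C≡J)
    term : ∀ g → labelledTerm R g ≈ 𝟙 (label ≐ᶠ g) ⊗ Kmonomial R
    term g with T? (label ≐ᶠ g)
    ... | no label≢g = trans (𝟙-𝟙-reject _ (λ v R≐κ → label≢g (≐ᶠ-complete (λ i →
                               ≡.sym (label-unique (validᵇ-sound v) (≐ᵇ-sound R≐κ) i)))))
                             (sym (𝟙-reject _ label≢g))
    ... | yes label≡g = begin
      labelledTerm R g                          ≈⟨ 𝟙-accept _ (validᵇ-complete valid) ⟩
      𝟙 (R ≐ᵇ kernel g) ⊗ Kmonomial (kernel g)  ≈⟨ 𝟙-accept _ (≐ᵇ-complete R≗κ) ⟩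
      Kmonomial (kernel g)                      ≡⟨ cong monomialAt (Kπ-cong R≗κ) ⟨
      Kmonomial R                               ≈⟨ 𝟙-accept _ label≡g ⟨
      𝟙 (label ≐ᶠ g) ⊗ Kmonomial R              ∎
      where
      label≗g : ∀ i → label i ≡ g i
      label≗g = ≐ᶠ-sound label≡g
      valid : Valid g
      valid e = ≡.subst (T ∘ admissible J (toℕ e)) (label≗g e) (label-valid e)
      R≗κ : R ≗₂ kernel g
      R≗κ i j = ≡.trans (R≗kernel-label i j) (cong₂ (λ a b → does (a Fin.≟ b)) (label≗g i) (label≗g j))

  per-relation : ∀ R → 𝟙 (isEquivᵇ R) ⊗ (𝟙 (C≡Jᵇ R) ⊗ Kmonomial R) ≈ ∑L labellings (labelledTerm R)
  per-relation R with T? (isEquivᵇ R) | T? (C≡Jᵇ R)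
  ... | yes equiv | yes C≡J = trans (𝟙-accept _ equiv) (trans (𝟙-accept _ C≡J) (unique-labelling R equiv C≡J))
  ... | no ¬equiv | _ = trans (𝟙-reject _ ¬equiv) (sym (no-labelling R (λ {g} _ → ¬equiv ∘ kernel⇒equiv g)))
    where
    kernel⇒equiv : ∀ g → R ≗₂ kernel g → T (isEquivᵇ R)
    kernel⇒equiv g R≗κ = isEquivᵇ-complete R (IsEquivalence-resp R≗κ (kernel-equiv g))
  ... | yes _ | no ¬C≡J = trans (*-cong ≈-refl (𝟙-reject _ ¬C≡J))
                                (trans (zeroʳ _) (sym (no-labelling R λ v → ¬C≡J ∘ kernel⇒C≡J v)))
    where
    kernel⇒C≡J : ∀ {g} → Valid g → R ≗₂ kernel g → T (C≡Jᵇ R)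
    kernel⇒C≡J v R≗κ = ≡.subst (λ C → T (listEqᵇ C (toList J))) (≡.sym (≡.trans (Cπ-cong R≗κ) (Cπ-kernel v)))
                                (listEqᵇ-refl (toList J))

  ∑-relations-as-labellings : ∑L (allRels n) (λ R → 𝟙 (isEquivᵇ R) ⊗ (𝟙 (C≡Jᵇ R) ⊗ Kmonomial R))
                              ≈ ∑L labellings (λ g → 𝟙 (validᵇ g) ⊗ Kmonomial (kernel g))
  ∑-relations-as-labellings = begin
    ∑L (allRels n) (λ R → 𝟙 (isEquivᵇ R) ⊗ (𝟙 (C≡Jᵇ R) ⊗ Kmonomial R)) ≈⟨ ∑L-cong (allRels n) per-relation ⟩
    ∑L (allRels n) (λ R → ∑L labellings (labelledTerm R))             ≈⟨ ∑L-comm (allRels n) labellings labelledTerm ⟩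
    ∑L labellings (λ g → ∑L (allRels n) (λ R → labelledTerm R g))      ≈⟨ ∑L-cong labellings collapse ⟩
    ∑L labellings (λ g → 𝟙 (validᵇ g) ⊗ Kmonomial (kernel g))          ∎
    where
    collapse : ∀ g → ∑L (allRels n) (λ R → labelledTerm R g) ≈ 𝟙 (validᵇ g) ⊗ Kmonomial (kernel g)
    collapse g = begin
      ∑L (allRels n) (λ R → labelledTerm R g)
        ≈⟨ *-distribˡ-∑L (allRels n) (𝟙 (validᵇ g)) (λ R → 𝟙 (R ≐ᵇ kernel g) ⊗ Kmonomial (kernel g)) ⟨
      𝟙 (validᵇ g) ⊗ ∑L (allRels n) (λ R → 𝟙 (R ≐ᵇ kernel g) ⊗ Kmonomial (kernel g))
        ≈⟨ *-cong ≈-refl (*-distribʳ-∑L (allRels n) (Kmonomial (kernel g)) (λ R → 𝟙 (R ≐ᵇ kernel g))) ⟨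
      𝟙 (validᵇ g) ⊗ (∑L (allRels n) (λ R → 𝟙 (R ≐ᵇ kernel g)) ⊗ Kmonomial (kernel g))
        ≈⟨ *-cong ≈-refl (trans (*-cong (∑-≐ᵇ (kernel g)) ≈-refl) (*-identityˡ _)) ⟩
      𝟙 (validᵇ g) ⊗ Kmonomial (kernel g) ∎

  contribution : Fin n → Fin k → Carrier
  contribution e a = if isMax J (toℕ e) then 1# else x a

  Kmonomial-kernel : ∀ {g} → Valid g → Kmonomial (kernel g) ≈ ∏ (λ e → contribution e (g e))
  Kmonomial-kernel {g} valid = begin
    monomialAt (Kπ (kernel g))
      ≡⟨ cong monomialAt (Kπ-kernel valid) ⟩
    monomialAt (toList (blockSizes g))
      ≈⟨ ∑-compositions-δ (blockSizes g) (blockSize-bounds valid) (sum-blockSizes g) (monomial x) ⟩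
    monomial x (blockSizes g)
      ≈⟨ ∏-cong (λ s → reflexive (cong (pow (x s)) (blockSize-nonMax valid s))) ⟩
    ∏ (λ s → pow (x s) (countB (λ e → not (isMax J (toℕ e)) ∧ does (g e Fin.≟ s))))
      ≈⟨ ∏-pow-countB (not ∘ isMax J ∘ toℕ) g x ⟩
    ∏ (λ e → if not (isMax J (toℕ e)) then x (g e) else 1#)
      ≈⟨ ∏-cong {n} (λ e → reflexive (if-not (isMax J (toℕ e)))) ⟩
    ∏ (λ e → contribution e (g e)) ∎

  ∑-over-labellings : ∑L labellings (λ g → 𝟙 (validᵇ g) ⊗ Kmonomial (kernel g))
                      ≈ ∏ {n} (λ e → weight J x (toℕ e))
  ∑-over-labellings = begin
    ∑L labellings (λ g → 𝟙 (validᵇ g) ⊗ Kmonomial (kernel g))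
      ≈⟨ ∑L-cong labellings term ⟩
    ∑L labellings (λ g → ∏ (λ e → factor e (g e)))
      ≈⟨ ∑L-allFuns-∏ (allFin k) n factor ⟩
    ∏ (λ e → ∑L (allFin k) (factor e))
      ≈⟨ ∏-cong {n} (λ e → trans (reflexive (∑L-tabulate id (factor e))) (∑-admissible J pos x (toℕ e))) ⟩
    ∏ {n} (λ e → weight J x (toℕ e)) ∎
    where
    factor : Fin n → Fin k → Carrier
    factor e a = 𝟙 (admissible J (toℕ e) a) ⊗ contribution e a
    term : ∀ g → 𝟙 (validᵇ g) ⊗ Kmonomial (kernel g) ≈ ∏ (λ e → factor e (g e))
    term g = begin
      𝟙 (validᵇ g) ⊗ Kmonomial (kernel g)
        ≈⟨ 𝟙-*-cong (Kmonomial-kernel ∘ validᵇ-sound) ⟩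
      𝟙 (validᵇ g) ⊗ ∏ (λ e → contribution e (g e))
        ≈⟨ *-cong (∏-𝟙 (λ e → admissible J (toℕ e) (g e))) ≈-refl ⟨
      ∏ (λ e → 𝟙 (admissible J (toℕ e) (g e))) ⊗ ∏ (λ e → contribution e (g e))
        ≈⟨ ∏-* (λ e → 𝟙 (admissible J (toℕ e) (g e))) (λ e → contribution e (g e)) ⟨
      ∏ (λ e → factor e (g e)) ∎

mainTheorem6 : ∀ {c ℓ} (R : CommutativeSemiring c ℓ) (n k : ℕ) (J : Vec ℕ k) →
  (∀ s → 1 ≤ lookup J s) → Vec.sum J ≡ n →
  (x : Fin k → CommutativeSemiring.Carrier R) →
  let open CommutativeSemiring R
      open SemiringOps R
  in ∑L (compositions n k) (λ I → natMul (cIJ n I J) (∏ (λ s → pow (x s) (lookup I s ∸ 1))))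
     ≈ ∏ (λ s → pow (tailSum x s) (lookup J s ∸ 1))
mainTheorem6 S _ k J pos refl x =
  trans ∑-over-relations (trans ∑-relations-as-labellings (trans ∑-over-labellings (∏-weight J pos x)))
  where
  open CommutativeSemiring S using (trans)
  open GeneratingFunction S J pos x
  open PositionWeights S using (∏-weight)
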